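{- Let $m\geq 1$, $S=\{1,\ldots,2m+1\}$, $X$ the set of all $m$-subsets and $(m+1)$-subsets of $S$, and $2.O_{m+1}$ the graph on $X$ in which distinct $x,y$ are adjacent iff $x\subset y$ or $y\subset x$. Fix $x_0=\{1,\ldots,m\}$, let $G$ be the stabilizer of $x_0$ in $\mathrm{Aut}(2.O_{m+1})$, and let $\mathcal{A}$ be the centralizer algebra of $G$, i.e. the set of all $B\in\mathrm{Mat}_X(\mathbb{C})$ with $B_{\sigma y,\sigma z}=B_{y,z}$ for all $\sigma\in G$, $y,z\in X$. For $y,z\in X$ let $\varrho(y,z)=(|x_0\cap y|,|x_0\cap z|,|y\cap z|,|x_0\cap y\cap z|)$; for $a,b\in\{m,m+1\}$ let $\mathcal{I}_{(a,b)}=\{\varrho(y,z): y,z\in X,|y|=a,|z|=b\}$ and, for $(i,j,t,p)\in\mathcal{I}_{(a,b)}$, let $N^{(i,j,t,p)}_{(a,b)}\in\mathrm{Mat}_X(\mathbb{C})$ be the $0/1$ matrix whose $(y,z)$-entry is $1$ iff $|y|=a$, $|z|=b$ and $\varrho(y,z)=(i,j,t,p)$. (In the paper these are denoted $\mathcal{M}^{t,p}_{i,j}$, $\mathcal{R}^{t,p}_{i,j}$, $\mathcal{L}^{t,p}_{i,j}$, $\mathcal{F}^{t,p}_{i,j}$ for $(a,b)=(m,m),(m,m+1),(m+1,m),(m+1,m+1)$ respectively.) Then the matrices $N^{(i,j,t,p)}_{(a,b)}$, over all $a,b\in\{m,m+1\}$ and $(i,j,t,p)\in\mathcal{I}_{(a,b)}$,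 form a basis of $\mathcal{A}$, and $\dim\mathcal{A}=4\binom{m+4}{4}$.
   Context: It is known that $\mathrm{Aut}(2.O_{m+1})$ is induced by permutations of $S$ together with complementation $x\mapsto S-x$; the stabilizer of $x_0$ is induced by $\mathrm{Sym}(x_0)\times\mathrm{Sym}(S-x_0)$. -}

module Defs where

open import Level using (Level; _⊔_)
open import Data.Nat using (ℕ; zero; suc)
import Data.Nat as ℕ
open import Data.Nat.Properties using (_≟_)
open import Data.Bool using (Bool; true; false; _∧_; if_then_else_)
open import Data.Fin using (Fin)
import Data.Fin as Fin
open import Data.Vec using (Vec; []; _∷_; replicate; _++_)
open import Data.Fin.Subset using (Subset; inside; outside; ∣_∣; _∩_; _⊂_)
open import Data.Product using (Σ; ∃; ∃-syntax; _×_; _,_)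
open import Data.Sum using (_⊎_; inj₁; inj₂)
open import Relation.Nullary using (¬_; does)
open import Relation.Binary.PropositionalEquality using (_≡_; refl; cong)
open import Function.Bundles using (_↔_; Inverse; _⇔_)
open import Algebra.Bundles using (CommutativeRing)

-- Scalars: a field (stdlib has no ℂ and no Field bundle).

record Field (c ℓ : Level) : Set (Level.suc (c ⊔ ℓ)) where
  field
    commutativeRing : CommutativeRing c ℓ
  open CommutativeRing commutativeRing public
  field
    0≉1     : ¬ (0# ≈ 1#)
    inverse : ∀ x → ¬ (x ≈ 0#) → ∃[ y ] (x * y ≈ 1#)

-- The ground set S = {1,…,2m+1}, encoded as Fin (m + suc m);
-- element k of Fin corresponds to k+1 of S.

S# : ℕ → ℕ
S# m = m ℕ.+ suc m

-- Vertices of 2.O_{m+1}: m-subsets and (m+1)-subsets of S.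
-- (size proof irrelevant: a vertex is determined by its underlying set)
record Vtx (m : ℕ) : Set where
  constructor vtx
  field
    set   : Subset (S# m)
    .size : ∣ set ∣ ≡ m ⊎ ∣ set ∣ ≡ suc m
open Vtx public

Adj : ∀ {m} → Vtx m → Vtx m → Set
Adj x y = set x ⊂ set y ⊎ set y ⊂ set x

record Aut (m : ℕ) : Set where
  field
    perm    : Vtx m ↔ Vtx m
    adj-iff : ∀ x y → Adj x y ⇔ Adj (Inverse.to perm x) (Inverse.to perm y)
open Aut public

app : ∀ {m} → Aut m → Vtx m → Vtx m
app σ = Inverse.to (perm σ)

x₀-set : (m : ℕ) → Subset (S# m)
x₀-set m = replicate m inside ++ replicate (suc m) outside

private
  cnt-out : ∀ k → ∣ replicate k outside ∣ ≡ 0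
  cnt-out zero    = refl
  cnt-out (suc k) = cnt-out k

  cnt-x₀ : ∀ m k → ∣ replicate m inside ++ replicate k outside ∣ ≡ m
  cnt-x₀ zero    k = cnt-out k
  cnt-x₀ (suc m) k = cong suc (cnt-x₀ m k)

x₀ : (m : ℕ) → Vtx m
x₀ m = vtx (x₀-set m) (inj₁ (cnt-x₀ m (suc m)))

InG : ∀ {m} → Aut m → Set
InG {m} σ = app σ (x₀ m) ≡ x₀ m

ℕ⁴ : Set
ℕ⁴ = ℕ × ℕ × ℕ × ℕ

ϱ : ∀ {m} → Vtx m → Vtx m → ℕ⁴
ϱ {m} y z = ∣ x₀-set m ∩ set y ∣ , ∣ x₀-set m ∩ set z ∣ , ∣ set y ∩ set z ∣
          , ∣ x₀-set m ∩ set y ∩ set z ∣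

_≡ᵇ_ : ℕ → ℕ → Bool
a ≡ᵇ b = does (a ≟ b)

_≡⁴_ : ℕ⁴ → ℕ⁴ → Bool
(a , b , c , d) ≡⁴ (a' , b' , c' , d') = (a ≡ᵇ a') ∧ (b ≡ᵇ b') ∧ (c ≡ᵇ c') ∧ (d ≡ᵇ d')

-- Index set: (a,b) with a,b ∈ {m,m+1} and (i,j,t,p) ∈ 𝓘_(a,b).
-- (membership proof irrelevant: the index is the tuple (a,b,i,j,t,p) itself)
record Idx (m : ℕ) : Set where
  constructor idx
  field
    a b  : ℕ
    q    : ℕ⁴
    .a∈  : a ≡ m ⊎ a ≡ suc m
    .b∈  : b ≡ m ⊎ b ≡ suc m
    .mem : ∃[ y ] ∃[ z ] (∣ set y ∣ ≡ a × ∣ set z ∣ ≡ b × ϱ {m} y z ≡ q)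

module _ {c ℓ} (F : Field c ℓ) where
  open Field F

  Mat : ℕ → Set c
  Mat m = Vtx m → Vtx m → Carrier

  InCentralizer : ∀ {m} → Mat m → Set ℓ
  InCentralizer {m} B = ∀ (σ : Aut m) → InG σ → ∀ y z → B (app σ y) (app σ z) ≈ B y z

  N : ∀ {m} → Idx m → Mat m
  N (idx a b q _ _ _) y z =
    if (∣ set y ∣ ≡ᵇ a) ∧ (∣ set z ∣ ≡ᵇ b) ∧ (ϱ y z ≡⁴ q) then 1# else 0#

  ∑ : ∀ {n} → (Fin n → Carrier) → Carrier
  ∑ {zero}  f = 0#
  ∑ {suc n} f = f Fin.zero + ∑ (λ k → f (Fin.suc k))

  lincomb : ∀ {m d} → (Fin d → Carrier) → (Fin d → Mat m) → Mat m
  lincomb c v y z = ∑ (λ k → c k * v k y z)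

  IsBasisOf : ∀ {m d} → (Mat m → Set ℓ) → (Fin d → Mat m) → Set (c ⊔ ℓ)
  IsBasisOf {m} {d} P v =
      (∀ k → P (v k))
    × (∀ (c : Fin d → Carrier) → (∀ y z → lincomb c v y z ≈ 0#) → ∀ k → c k ≈ 0#)
    × (∀ (B : Mat m) → P B → ∃[ c ] (∀ y z → B y z ≈ lincomb c v y z))

module Submission where

-- An automorphism of 2.O_{m+1} preserves graph distance, which is the Hamming
-- distance of the underlying subsets.  Since the sizes of y and of x₀ determine the
-- parity of their distance, an automorphism σ fixing x₀ preserves sizes; then
-- b ∈ u iff u is closer to w ∪ {b} than to w (for w of size m avoiding b), so σ is
-- induced by a permutation of S preserving x₀, and it preserves the key
-- (∣y∣, ∣z∣, ϱ(y,z)).  Hence every N lies in 𝒜.  Conversely the key determines the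
-- numbers of points inside and outside x₀ of each of the four types (in y ∩ z, only
-- in y, only in z, in neither), and two pairs with the same such counts are related
-- by transpositions of adjacent points that both lie in x₀ or both lie outside it;
-- these transpositions are automorphisms in G, so every B ∈ 𝒜 is a combination of
-- the N, which have disjoint nonempty supports.
--
-- For the dimension, pair the count of each type inside x₀ with the count of the
-- complementary type outside.  In a fixed size class (∣y∣, ∣z∣) a valid choice of
-- counts is determined by the four minima of the pairs and by one integer offset,
-- and the offset contributes to the count m inside x₀ through a zigzag bijection
-- ℤ ≃ ℕ.  So each of the four size classes is in bijection with the compositions of
-- m into five parts, of which there are C(m+4,4).

open import Defs
import Algebra.Properties.CommutativeMonoid.Sum as Sum
open import Data.Bool using (Bool; true; false; not; _∧_; _xor_; if_then_else_)
open import Data.Bool.Properties using (not-involutive; ⇔→≡) renaming (_≟_ to _≟ᵇ_)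
open import Data.Empty using (⊥-elim)
open import Data.Fin using (Fin; zero; suc; _↑ʳ_)
import Data.Fin as Fin
open import Data.Fin.Permutation using (Permutation; permutation; _⟨$⟩ʳ_)
open import Data.Fin.Properties using (+↔⊎; *↔×; 1↔⊤; 2↔Bool)
import Data.Fin.Properties as Finₚ
open import Data.Fin.Subset using (Subset; ∣_∣; _∈_; _⊆_; _⊂_; _∩_; inside; outside)
open import Data.Fin.Subset.Properties using (drop-∷-⊆; p⊂q⇒∣p∣<∣q∣)
open import Data.Integer using (ℤ; -[1+_]; -_; pred; _⊖_) renaming (suc to sucℤ)
import Data.Integer as ℤ using (+_)
open import Data.Integer.Properties using (neg-involutive) renaming (suc-pred to sucℤ-pred; pred-suc to pred-sucℤ)
open import Data.Nat using (ℕ; zero; suc; _+_; _*_; _∸_; _⊓_; _≤_; _<_; z≤n; s≤s; s≤s⁻¹)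
open import Data.Nat.Combinatorics using (_C_; nCn≡1; nCk+nC[k+1]≡[n+1]C[k+1])
open import Data.Nat.Properties
open import Data.Nat.Tactic.RingSolver using (solve-∀)
open import Data.Product using (Σ-syntax; ∃-syntax; _×_; _,_; proj₁; proj₂; uncurry)
open import Data.Product.Function.NonDependent.Propositional using (_×-↔_)
open import Data.Product.Properties using (≡-dec)
open import Data.Sum using (_⊎_; inj₁; inj₂)
open import Data.Sum.Function.Propositional using (_⊎-↔_)
open import Data.Unit using (⊤; tt)
open import Data.Vec using (Vec; []; _∷_; lookup; zipWith; zip; unzip; map; replicate; _++_; splitAt; updateAt; count; sum; here)
open import Data.Vec.Properties
  using ( lookup∘updateAt; lookup∘updateAt′; updateAt-updateAt-local; updateAt-id; []=⇒lookup; lookup⇒[]=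
        ; lookup-++ʳ; lookup-replicate; lookup-zipWith; unzip∘zip; map-proj₁-zip; map-proj₂-zip; map-++; ++-injective)
open import Function.Base using (_∘_)
open import Function.Bundles using (_↔_; _⇔_; Inverse; Equivalence; mk↔ₛ′; mk⇔)
import Function.Properties.Equivalence as ⇔
open import Function.Properties.Inverse using (↔-trans; ↔-sym; ↔-refl)
open import Relation.Binary.Construct.Closure.ReflexiveTransitive using (Star; ε; _◅_; _◅◅_; gmap)
open import Relation.Binary.Definitions using (DecidableEquality)
open import Relation.Binary.PropositionalEquality
open import Relation.Nullary using (¬_; yes; no; does; contradiction)
open import Relation.Nullary.Decidable using (Dec; recompute; dec-true; dec-false; map′; _×-dec_; _⊎-dec_)
open import Relation.Unary using (Pred; Decidable)

private variable
  X Y Z : Set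
  k m n : ℕ

-- Hamming distance

dist : Subset n → Subset n → ℕ
dist p q = ∣ zipWith _xor_ p q ∣

flip : Fin n → Subset n → Subset n
flip i p = updateAt p i not

dist-sym : (p q : Subset n) → dist p q ≡ dist q p
dist-sym []          []          = refl
dist-sym (true  ∷ p) (true  ∷ q) = dist-sym p q
dist-sym (true  ∷ p) (false ∷ q) = cong suc (dist-sym p q)
dist-sym (false ∷ p) (true  ∷ q) = cong suc (dist-sym p q)
dist-sym (false ∷ p) (false ∷ q) = dist-sym p q

dist-refl : (p : Subset n) → dist p p ≡ 0
dist-refl []          = refl
dist-refl (true  ∷ p) = dist-refl p
dist-refl (false ∷ p) = dist-refl p

dist≡0⇒≡ : (p q : Subset n) → dist p q ≡ 0 → p ≡ q
dist≡0⇒≡ []          []          _ = refl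
dist≡0⇒≡ (true  ∷ p) (true  ∷ q) e = cong (true ∷_) (dist≡0⇒≡ p q e)
dist≡0⇒≡ (false ∷ p) (false ∷ q) e = cong (false ∷_) (dist≡0⇒≡ p q e)

dist-triangle : (p q r : Subset n) → dist p r ≤ dist p q + dist q r
dist-triangle []          []          []          = z≤n
dist-triangle (true  ∷ p) (true  ∷ q) (true  ∷ r) = dist-triangle p q r
dist-triangle (true  ∷ p) (true  ∷ q) (false ∷ r) = ≤-trans (s≤s (dist-triangle p q r)) (≤-reflexive (sym (+-suc _ _)))
dist-triangle (true  ∷ p) (false ∷ q) (true  ∷ r) = ≤-trans (dist-triangle p q r) (≤-trans (n≤1+n _) (s≤s (+-monoʳ-≤ _ (n≤1+n _))))
dist-triangle (true  ∷ p) (false ∷ q) (false ∷ r) = s≤s (dist-triangle p q r)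
dist-triangle (false ∷ p) (true  ∷ q) (true  ∷ r) = s≤s (dist-triangle p q r)
dist-triangle (false ∷ p) (true  ∷ q) (false ∷ r) = ≤-trans (dist-triangle p q r) (≤-trans (n≤1+n _) (s≤s (+-monoʳ-≤ _ (n≤1+n _))))
dist-triangle (false ∷ p) (false ∷ q) (true  ∷ r) = ≤-trans (s≤s (dist-triangle p q r)) (≤-reflexive (sym (+-suc _ _)))
dist-triangle (false ∷ p) (false ∷ q) (false ∷ r) = dist-triangle p q r

dist-flip-agree : (i : Fin n) (p q : Subset n) → lookup p i ≡ lookup q i → dist p (flip i q) ≡ suc (dist p q)
dist-flip-agree zero    (true  ∷ p) (true  ∷ q) _ = refl
dist-flip-agree zero    (false ∷ p) (false ∷ q) _ = refl
dist-flip-agree (suc i) (true  ∷ p) (true  ∷ q) e = dist-flip-agree i p q e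
dist-flip-agree (suc i) (true  ∷ p) (false ∷ q) e = cong suc (dist-flip-agree i p q e)
dist-flip-agree (suc i) (false ∷ p) (true  ∷ q) e = cong suc (dist-flip-agree i p q e)
dist-flip-agree (suc i) (false ∷ p) (false ∷ q) e = dist-flip-agree i p q e

dist-flip-disagree : (i : Fin n) (p q : Subset n) → lookup p i ≡ not (lookup q i) → suc (dist p (flip i q)) ≡ dist p q
dist-flip-disagree zero    (true  ∷ p) (false ∷ q) _ = refl
dist-flip-disagree zero    (false ∷ p) (true  ∷ q) _ = refl
dist-flip-disagree (suc i) (true  ∷ p) (true  ∷ q) e = dist-flip-disagree i p q e
dist-flip-disagree (suc i) (true  ∷ p) (false ∷ q) e = cong suc (dist-flip-disagree i p q e)
dist-flip-disagree (suc i) (false ∷ p) (true  ∷ q) e = cong suc (dist-flip-disagree i p q e)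
dist-flip-disagree (suc i) (false ∷ p) (false ∷ q) e = dist-flip-disagree i p q e

dist≡1⇒flip : (p q : Subset n) → dist p q ≡ 1 → ∃[ i ] q ≡ flip i p
dist≡1⇒flip []          []          ()
dist≡1⇒flip (true  ∷ p) (false ∷ q) e = zero , cong (false ∷_) (sym (dist≡0⇒≡ p q (suc-injective e)))
dist≡1⇒flip (false ∷ p) (true  ∷ q) e = zero , cong (true ∷_) (sym (dist≡0⇒≡ p q (suc-injective e)))
dist≡1⇒flip (true  ∷ p) (true  ∷ q) e with dist≡1⇒flip p q e
... | i , q≡ = suc i , cong (true ∷_) q≡
dist≡1⇒flip (false ∷ p) (false ∷ q) e with dist≡1⇒flip p q e
... | i , q≡ = suc i , cong (false ∷_) q≡

flip-involutive : (i : Fin n) (p : Subset n) → flip i (flip i p) ≡ p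
flip-involutive i p = trans (updateAt-updateAt-local i p (not-involutive _)) (updateAt-id i p)

∣flip∣-outside : (i : Fin n) (p : Subset n) → lookup p i ≡ false → ∣ flip i p ∣ ≡ suc ∣ p ∣
∣flip∣-outside zero    (false ∷ p) _ = refl
∣flip∣-outside (suc i) (true  ∷ p) e = cong suc (∣flip∣-outside i p e)
∣flip∣-outside (suc i) (false ∷ p) e = ∣flip∣-outside i p e

∣flip∣-inside : (i : Fin n) (p : Subset n) → lookup p i ≡ true → suc ∣ flip i p ∣ ≡ ∣ p ∣
∣flip∣-inside zero    (true  ∷ p) _ = refl
∣flip∣-inside (suc i) (true  ∷ p) e = cong suc (∣flip∣-inside i p e)
∣flip∣-inside (suc i) (false ∷ p) e = ∣flip∣-inside i p e

flip-⊂ : (i : Fin n) (p : Subset n) → lookup p i ≡ false → p ⊂ flip i p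
flip-⊂ i p pᵢ≡false = grow , i , lookup⇒[]= i _ (trans (lookup∘updateAt i p) (cong not pᵢ≡false)) , i∉p
  where
  i∉p : ¬ i ∈ p
  i∉p i∈p with () ← trans (sym ([]=⇒lookup i∈p)) pᵢ≡false
  grow : p ⊆ flip i p
  grow {j} j∈p with j Finₚ.≟ i
  ... | yes refl = ⊥-elim (i∉p j∈p)
  ... | no j≢i = lookup⇒[]= j _ (trans (lookup∘updateAt′ j i j≢i p) ([]=⇒lookup j∈p))

p⊆q⇒∣q∣≡∣p∣+dist : (p q : Subset n) → p ⊆ q → ∣ q ∣ ≡ ∣ p ∣ + dist p q
p⊆q⇒∣q∣≡∣p∣+dist []          []          _   = refl
p⊆q⇒∣q∣≡∣p∣+dist (true  ∷ p) (true  ∷ q) p⊆q = cong suc (p⊆q⇒∣q∣≡∣p∣+dist p q (drop-∷-⊆ p⊆q))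
p⊆q⇒∣q∣≡∣p∣+dist (true  ∷ p) (false ∷ q) p⊆q with () ← p⊆q here
p⊆q⇒∣q∣≡∣p∣+dist (false ∷ p) (true  ∷ q) p⊆q = trans (cong suc (p⊆q⇒∣q∣≡∣p∣+dist p q (drop-∷-⊆ p⊆q))) (sym (+-suc _ _))
p⊆q⇒∣q∣≡∣p∣+dist (false ∷ p) (false ∷ q) p⊆q = p⊆q⇒∣q∣≡∣p∣+dist p q (drop-∷-⊆ p⊆q)

dist+2∣∩∣ : (p q : Subset n) → dist p q + 2 * ∣ p ∩ q ∣ ≡ ∣ p ∣ + ∣ q ∣
dist+2∣∩∣ []          []          = refl
dist+2∣∩∣ (true  ∷ p) (true  ∷ q) = trans (step (dist p q) (∣ p ∩ q ∣)) (cong suc (trans (cong suc (dist+2∣∩∣ p q)) (sym (+-suc _ _))))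
  where
  step : ∀ d i → d + 2 * suc i ≡ suc (suc (d + 2 * i))
  step = solve-∀
dist+2∣∩∣ (true  ∷ p) (false ∷ q) = cong suc (dist+2∣∩∣ p q)
dist+2∣∩∣ (false ∷ p) (true  ∷ q) = trans (cong suc (dist+2∣∩∣ p q)) (sym (+-suc _ _))
dist+2∣∩∣ (false ∷ p) (false ∷ q) = dist+2∣∩∣ p q

∃-new-element : (p q : Subset n) → ∣ p ∣ ≤ ∣ q ∣ → p ≢ q → ∃[ i ] (lookup p i ≡ false × lookup q i ≡ true)
∃-new-element []          []          _  p≢q = ⊥-elim (p≢q refl)
∃-new-element (false ∷ p) (true  ∷ q) _  _   = zero , refl , refl
∃-new-element (true  ∷ p) (true  ∷ q) le p≢q with ∃-new-element p q (s≤s⁻¹ le) (p≢q ∘ cong (true ∷_))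
... | i , pᵢ , qᵢ = suc i , pᵢ , qᵢ
∃-new-element (false ∷ p) (false ∷ q) le p≢q with ∃-new-element p q le (p≢q ∘ cong (false ∷_))
... | i , pᵢ , qᵢ = suc i , pᵢ , qᵢ
∃-new-element (true  ∷ p) (false ∷ q) le _   with ∃-new-element p q (≤-trans (n≤1+n _) le) (λ { refl → 1+n≰n le })
... | i , pᵢ , qᵢ = suc i , pᵢ , qᵢ

∈⇔closer-to-flip : (i : Fin n) (p q : Subset n) → lookup q i ≡ false →
                   (lookup p i ≡ true ⇔ dist p (flip i q) < dist p q)
∈⇔closer-to-flip i p q qᵢ≡false = mk⇔ closer agree
  where
  closer : lookup p i ≡ true → dist p (flip i q) < dist p q
  closer pᵢ≡true = ≤-reflexive (dist-flip-disagree i p q (trans pᵢ≡true (cong not (sym qᵢ≡false))))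
  agree : dist p (flip i q) < dist p q → lookup p i ≡ true
  agree lt with lookup p i in pᵢ
  ... | true  = refl
  ... | false = ⊥-elim (<-asym lt (≤-reflexive (sym (dist-flip-agree i p q (trans pᵢ (sym qᵢ≡false))))))

dist-flip-towards : ∀ {k} (i : Fin n) (p q : Subset n) → lookup q i ≡ not (lookup p i) →
                    dist p q ≡ suc k → dist (flip i p) q ≡ k
dist-flip-towards {k = k} i p q qᵢ≡¬pᵢ dist≡ = suc-injective (begin
  suc (dist (flip i p) q) ≡⟨ cong suc (dist-sym (flip i p) q) ⟩
  suc (dist q (flip i p)) ≡⟨ dist-flip-disagree i q p qᵢ≡¬pᵢ ⟩
  dist q p                ≡⟨ dist-sym q p ⟩
  dist p q                ≡⟨ dist≡ ⟩
  suc k                   ∎)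
  where open ≡-Reasoning

dist≡suc⇒≢ : ∀ {k} (p q : Subset n) → dist p q ≡ suc k → p ≢ q
dist≡suc⇒≢ p q dist≡ refl = 0≢1+n (trans (sym (dist-refl p)) dist≡)

-- Graph distance

IsSize : ℕ → ℕ → Set
IsSize m s = s ≡ m ⊎ s ≡ suc m

vertex-size : (x : Vtx m) → IsSize m ∣ set x ∣
vertex-size (vtx p p-size) = recompute (∣ p ∣ ≟ _ ⊎-dec ∣ p ∣ ≟ _) p-size

m≤size : (x : Vtx m) → m ≤ ∣ set x ∣
m≤size x with vertex-size x
... | inj₁ e = ≤-reflexive (sym e)
... | inj₂ e = ≤-trans (n≤1+n _) (≤-reflexive (sym e))

size≤1+m : (x : Vtx m) → ∣ set x ∣ ≤ suc m
size≤1+m x with vertex-size x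
... | inj₁ e = ≤-trans (≤-reflexive e) (n≤1+n _)
... | inj₂ e = ≤-reflexive e

vtx-≡ : {x y : Vtx m} → set x ≡ set y → x ≡ y
vtx-≡ {x = vtx p _} refl = refl

D : Vtx m → Vtx m → ℕ
D x y = dist (set x) (set y)

⊂⇒D≡1 : (x y : Vtx m) → set x ⊂ set y → D x y ≡ 1
⊂⇒D≡1 {m} x y x⊂y = +-cancelˡ-≡ ∣ set x ∣ _ _ (begin
    ∣ set x ∣ + D x y   ≡⟨ p⊆q⇒∣q∣≡∣p∣+dist _ _ (proj₁ x⊂y) ⟨
    ∣ set y ∣           ≡⟨ ≤-antisym (size≤1+m y) (≤-trans (s≤s (m≤size x)) (p⊂q⇒∣p∣<∣q∣ x⊂y)) ⟩
    suc m               ≡⟨ cong suc ∣x∣≡m ⟨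
    suc ∣ set x ∣       ≡⟨ +-comm 1 _ ⟩
    ∣ set x ∣ + 1       ∎)
  where
  open ≡-Reasoning
  ∣x∣≡m : ∣ set x ∣ ≡ m
  ∣x∣≡m = ≤-antisym (s≤s⁻¹ (≤-trans (p⊂q⇒∣p∣<∣q∣ x⊂y) (size≤1+m y))) (m≤size x)

Adj⇒D≡1 : (x y : Vtx m) → Adj x y → D x y ≡ 1
Adj⇒D≡1 x y (inj₁ x⊂y) = ⊂⇒D≡1 x y x⊂y
Adj⇒D≡1 x y (inj₂ y⊂x) = trans (dist-sym (set x) (set y)) (⊂⇒D≡1 y x y⊂x)

D≡1⇒Adj : (x y : Vtx m) → D x y ≡ 1 → Adj x y
D≡1⇒Adj x y D≡1 with dist≡1⇒flip (set x) (set y) D≡1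
... | i , y≡ with lookup (set x) i in xᵢ
... | false = inj₁ (subst (set x ⊂_) (sym y≡) (flip-⊂ i (set x) xᵢ))
... | true  = inj₂ (subst₂ _⊂_ (sym y≡) (flip-involutive i (set x))
                     (flip-⊂ i (flip i (set x)) (trans (lookup∘updateAt i (set x)) (cong not xᵢ))))

data Walk {m} : Vtx m → Vtx m → ℕ → Set where
  []  : ∀ {x} → Walk x x 0
  _∷_ : ∀ {x w y k} → Adj x w → Walk w y k → Walk x y (suc k)

D≤length : {x y : Vtx m} → Walk x y k → D x y ≤ k
D≤length {x = x} [] = ≤-reflexive (dist-refl (set x))
D≤length {x = x} {y} (_∷_ {w = w} x~w walk) = begin
  D x y          ≤⟨ dist-triangle (set x) (set w) (set y) ⟩
  D x w + D w y  ≡⟨ cong (_+ D w y) (Adj⇒D≡1 x w x~w) ⟩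
  suc (D w y)    ≤⟨ s≤s (D≤length walk) ⟩
  suc _          ∎
  where open ≤-Reasoning

map-Walk : (f : Vtx m → Vtx m) → (∀ x y → Adj x y → Adj (f x) (f y)) →
           {x y : Vtx m} → Walk x y k → Walk (f x) (f y) k
map-Walk f f-adj []             = []
map-Walk f f-adj (x~w ∷ walk) = f-adj _ _ x~w ∷ map-Walk f f-adj walk

-- add a point of y − x when ∣x∣ = m, remove a point of x − y when ∣x∣ = m + 1
step-towards : (x y : Vtx m) → D x y ≡ suc k → ∃[ w ] (Adj x w × D w y ≡ k)
step-towards {m} x y Dxy with vertex-size x
... | inj₁ ∣x∣≡m with ∃-new-element (set x) (set y) (≤-trans (≤-reflexive ∣x∣≡m) (m≤size y)) (dist≡suc⇒≢ _ _ Dxy)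
...   | i , xᵢ , yᵢ =
  vtx (flip i (set x)) (inj₂ (trans (∣flip∣-outside i (set x) xᵢ) (cong suc ∣x∣≡m))) ,
  inj₁ (flip-⊂ i (set x) xᵢ) ,
  dist-flip-towards i (set x) (set y) (trans yᵢ (cong not (sym xᵢ))) Dxy
step-towards {m} x y Dxy
    | inj₂ ∣x∣≡1+m with ∃-new-element (set y) (set x) (≤-trans (size≤1+m y) (≤-reflexive (sym ∣x∣≡1+m)))
                                     (dist≡suc⇒≢ _ _ (trans (dist-sym (set y) (set x)) Dxy))
...   | i , yᵢ , xᵢ =
  vtx (flip i (set x)) (inj₁ (suc-injective (trans (∣flip∣-inside i (set x) xᵢ) ∣x∣≡1+m))) ,
  inj₂ (subst (flip i (set x) ⊂_) (flip-involutive i (set x))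
          (flip-⊂ i (flip i (set x)) (trans (lookup∘updateAt i (set x)) (cong not xᵢ)))) ,
  dist-flip-towards i (set x) (set y) (trans yᵢ (cong not (sym xᵢ))) Dxy

geodesic : (x y : Vtx m) → D x y ≡ k → Walk x y k
geodesic {k = zero}  x y Dxy = subst (λ z → Walk x z 0) (vtx-≡ (dist≡0⇒≡ (set x) (set y) Dxy)) []
geodesic {k = suc k} x y Dxy with step-towards x y Dxy
... | w , x~w , Dwy = x~w ∷ geodesic w y Dwy

module _ (σ : Aut m) where

  app⁻¹ : Vtx m → Vtx m
  app⁻¹ = Inverse.from (perm σ)

  app-app⁻¹ : ∀ x → app σ (app⁻¹ x) ≡ x
  app-app⁻¹ = Inverse.strictlyInverseˡ (perm σ)

  app⁻¹-app : ∀ x → app⁻¹ (app σ x) ≡ x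
  app⁻¹-app = Inverse.strictlyInverseʳ (perm σ)

  app-Adj : ∀ x y → Adj x y → Adj (app σ x) (app σ y)
  app-Adj x y = Equivalence.to (adj-iff σ x y)

  app⁻¹-Adj : ∀ x y → Adj x y → Adj (app⁻¹ x) (app⁻¹ y)
  app⁻¹-Adj x y x~y = Equivalence.from (adj-iff σ (app⁻¹ x) (app⁻¹ y))
                        (subst₂ Adj (sym (app-app⁻¹ x)) (sym (app-app⁻¹ y)) x~y)

  D-app : ∀ x y → D (app σ x) (app σ y) ≡ D x y
  D-app x y = ≤-antisym (shrinks (app σ) app-Adj x y) (begin
    D x y                                        ≡⟨ cong₂ D (app⁻¹-app x) (app⁻¹-app y) ⟨
    D (app⁻¹ (app σ x)) (app⁻¹ (app σ y))        ≤⟨ shrinks app⁻¹ app⁻¹-Adj (app σ x) (app σ y) ⟩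
    D (app σ x) (app σ y)                        ∎)
    where
    open ≤-Reasoning
    shrinks : (f : Vtx m → Vtx m) → (∀ x y → Adj x y → Adj (f x) (f y)) → ∀ x y → D (f x) (f y) ≤ D x y
    shrinks f f-adj x y = D≤length (map-Walk f f-adj (geodesic x y refl))

  D-app⁻¹ : ∀ x y → D (app⁻¹ x) (app⁻¹ y) ≡ D x y
  D-app⁻¹ x y = trans (sym (D-app (app⁻¹ x) (app⁻¹ y))) (cong₂ D (app-app⁻¹ x) (app-app⁻¹ y))

-- The stabilizer of x₀ acts on points

equidistant⇒∣∣≢suc : (p q r : Subset n) → dist p q ≡ dist p r → ∣ r ∣ ≢ suc ∣ q ∣
equidistant⇒∣∣≢suc p q r same ∣r∣≡ = even≢odd ∣ p ∩ r ∣ ∣ p ∩ q ∣ (+-cancelˡ-≡ (dist p q) _ _ (begin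
  dist p q + 2 * ∣ p ∩ r ∣        ≡⟨ cong (_+ 2 * ∣ p ∩ r ∣) same ⟩
  dist p r + 2 * ∣ p ∩ r ∣        ≡⟨ dist+2∣∩∣ p r ⟩
  ∣ p ∣ + ∣ r ∣                   ≡⟨ cong (∣ p ∣ +_) ∣r∣≡ ⟩
  ∣ p ∣ + suc ∣ q ∣               ≡⟨ +-suc _ _ ⟩
  suc (∣ p ∣ + ∣ q ∣)             ≡⟨ cong suc (dist+2∣∩∣ p q) ⟨
  suc (dist p q + 2 * ∣ p ∩ q ∣)  ≡⟨ +-suc _ _ ⟨
  dist p q + suc (2 * ∣ p ∩ q ∣)  ∎))
  where open ≡-Reasoning

∣x₀∣ : ∀ m → ∣ x₀-set m ∣ ≡ m
∣x₀∣ m = go m (suc m)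
  where
  go : ∀ i k → ∣ replicate i inside ++ replicate k outside ∣ ≡ i
  go zero    zero    = refl
  go zero    (suc k) = go zero k
  go (suc i) k       = cong suc (go i k)

module _ {m : ℕ} where

  private
    a₀ : Fin (S# m)
    a₀ = m ↑ʳ Fin.zero

    a₀∉x₀ : lookup (x₀-set m) a₀ ≡ false
    a₀∉x₀ = trans (lookup-++ʳ (replicate m inside) (replicate (suc m) outside) (Fin.zero {m})) (lookup-replicate (Fin.zero {m}) outside)

  avoiding : (b : Fin (S# m)) → ∃[ w ] (∣ set w ∣ ≡ m × lookup (set w) b ≡ false)
  avoiding b with lookup (x₀-set m) b in b∈x₀
  ... | false = x₀ m , ∣x₀∣ m , b∈x₀
  ... | true  = vtx w (inj₁ ∣w∣≡m) , ∣w∣≡m , b∉w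
    where
    a₀≢b : a₀ ≢ b
    a₀≢b a₀≡b with () ← trans (sym a₀∉x₀) (trans (cong (lookup (x₀-set m)) a₀≡b) b∈x₀)
    x₀-b = flip b (x₀-set m)
    w = flip a₀ x₀-b
    a₀∉x₀-b : lookup x₀-b a₀ ≡ false
    a₀∉x₀-b = trans (lookup∘updateAt′ a₀ b a₀≢b (x₀-set m)) a₀∉x₀
    ∣w∣≡m : ∣ w ∣ ≡ m
    ∣w∣≡m = trans (∣flip∣-outside a₀ x₀-b a₀∉x₀-b) (trans (∣flip∣-inside b (x₀-set m) b∈x₀) (∣x₀∣ m))
    b∉w : lookup w b ≡ false
    b∉w = trans (lookup∘updateAt′ b a₀ (a₀≢b ∘ sym) x₀-b) (trans (lookup∘updateAt b (x₀-set m)) (cong not b∈x₀))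

  add-point : (w : Vtx m) (b : Fin (S# m)) → ∣ set w ∣ ≡ m → lookup (set w) b ≡ false → Vtx m
  add-point w b ∣w∣≡m b∉w = vtx (flip b (set w)) (inj₂ (trans (∣flip∣-outside b (set w) b∉w) (cong suc ∣w∣≡m)))

  points-separated : (c b : Fin (S# m)) → (∀ v → lookup (set v) c ≡ lookup (set v) b) → c ≡ b
  points-separated c b same with c Finₚ.≟ b | avoiding b
  ... | yes c≡b | _ = c≡b
  ... | no c≢b | w , ∣w∣≡m , b∉w with lookup (set w) c in c∈w
  ...   | true  = contradiction (trans (sym c∈w) (trans (same w) b∉w)) λ ()
  ...   | false = contradiction (trans (sym c∉w+b) (trans (same w+b) b∈w+b)) λ ()
    where
    w+b = add-point w b ∣w∣≡m b∉w
    c∉w+b : lookup (set w+b) c ≡ false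
    c∉w+b = trans (lookup∘updateAt′ c b c≢b (set w)) c∈w
    b∈w+b : lookup (set w+b) b ≡ true
    b∈w+b = trans (lookup∘updateAt b (set w)) (cong not b∉w)

  module PointImage (f : Vtx m → Vtx m) (f-D : ∀ x y → D (f x) (f y) ≡ D x y) (f-x₀ : f (x₀ m) ≡ x₀ m) where

    D-x₀ : ∀ y → D (x₀ m) (f y) ≡ D (x₀ m) y
    D-x₀ y = trans (cong (λ v → D v (f y)) (sym f-x₀)) (f-D (x₀ m) y)

    size-preserved : ∀ y → ∣ set (f y) ∣ ≡ ∣ set y ∣
    size-preserved y with vertex-size (f y) | vertex-size y
    ... | inj₁ e | inj₁ e′ = trans e (sym e′)
    ... | inj₂ e | inj₂ e′ = trans e (sym e′)
    ... | inj₁ e | inj₂ e′ = ⊥-elim (equidistant⇒∣∣≢suc (x₀-set m) (set (f y)) (set y) (D-x₀ y) (trans e′ (cong suc (sym e))))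
    ... | inj₂ e | inj₁ e′ = ⊥-elim (equidistant⇒∣∣≢suc (x₀-set m) (set y) (set (f y)) (sym (D-x₀ y)) (trans e (cong suc (sym e′))))

    -- b ∈ u iff u is closer to w ∪ {b} than to w, and f preserves both distances
    image-through : ∀ {b} (w : Vtx m) (∣w∣≡m : ∣ set w ∣ ≡ m) (b∉w : lookup (set w) b ≡ false) →
                    ∃[ c ] (∀ u → lookup (set (f u)) c ≡ lookup (set u) b)
    image-through {b} w ∣w∣≡m b∉w
      with dist≡1⇒flip (set (f w)) (set (f (add-point w b ∣w∣≡m b∉w)))
             (trans (f-D w _) (trans (dist-flip-agree b (set w) (set w) refl) (cong suc (dist-refl (set w)))))
    ... | c , fw+b≡ = c , λ u → ⇔→≡ (⇔.trans (∈⇔closer-to-flip c (set (f u)) (set (f w)) c∉fw)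
                                     (⇔.trans (closer⇔ u) (⇔.sym (∈⇔closer-to-flip b (set u) (set w) b∉w))))
      where
      w+b = add-point w b ∣w∣≡m b∉w
      c∉fw : lookup (set (f w)) c ≡ false
      c∉fw with lookup (set (f w)) c in c∈fw
      ... | false = refl
      ... | true  = ⊥-elim (m≢1+n+m m (sym (begin
        suc (suc m)                    ≡⟨ cong suc (trans (∣flip∣-outside b (set w) b∉w) (cong suc ∣w∣≡m)) ⟨
        suc ∣ set w+b ∣                ≡⟨ cong suc (size-preserved w+b) ⟨
        suc ∣ set (f w+b) ∣            ≡⟨ cong (suc ∘ ∣_∣) fw+b≡ ⟩
        suc ∣ flip c (set (f w)) ∣     ≡⟨ ∣flip∣-inside c (set (f w)) c∈fw ⟩
        ∣ set (f w) ∣                  ≡⟨ trans (size-preserved w) ∣w∣≡m ⟩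
        m                              ∎)))
        where open ≡-Reasoning
      closer⇔ : ∀ u → (dist (set (f u)) (flip c (set (f w))) < D (f u) (f w)) ⇔ (D u w+b < D u w)
      closer⇔ u = mk⇔ (subst₂ _<_ (trans (cong (dist (set (f u))) (sym fw+b≡)) (f-D u w+b)) (f-D u w))
                      (subst₂ _<_ (trans (sym (f-D u w+b)) (cong (dist (set (f u))) fw+b≡)) (sym (f-D u w)))

    point-image : (b : Fin (S# m)) → ∃[ c ] (∀ u → lookup (set (f u)) c ≡ lookup (set u) b)
    point-image b with avoiding b
    ... | w , ∣w∣≡m , b∉w = image-through w ∣w∣≡m b∉w

record Transports (π : Permutation n n) (p q : Subset n) : Set where
  constructor transports
  field transport : ∀ b → lookup q (π ⟨$⟩ʳ b) ≡ lookup p b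
open Transports

transports-∩ : ∀ {π : Permutation n n} {p q p′ q′} →
               Transports π p q → Transports π p′ q′ → Transports π (p ∩ p′) (q ∩ q′)
transports-∩ {π = π} {p} {q} {p′} {q′} p↦q p′↦q′ = transports λ b → begin
  lookup (q ∩ q′) (π ⟨$⟩ʳ b)                      ≡⟨ lookup-zipWith _∧_ (π ⟨$⟩ʳ b) q q′ ⟩
  lookup q (π ⟨$⟩ʳ b) ∧ lookup q′ (π ⟨$⟩ʳ b)      ≡⟨ cong₂ _∧_ (transport p↦q b) (transport p′↦q′ b) ⟩
  lookup p b ∧ lookup p′ b                        ≡⟨ lookup-zipWith _∧_ b p p′ ⟨
  lookup (p ∩ p′) b                               ∎
  where open ≡-Reasoning

transports-∣∣ : ∀ {π : Permutation n n} {p q} → Transports π p q → ∣ q ∣ ≡ ∣ p ∣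
transports-∣∣ {π = π} {p} {q} p↦q = begin
  ∣ q ∣                                  ≡⟨ ∣∣≡sum q ⟩
  ∑ℕ (indicator q)                      ≡⟨ sum-permute (indicator q) π ⟩
  ∑ℕ (indicator q ∘ (π ⟨$⟩ʳ_))          ≡⟨ sum-cong-≗ (cong toℕ ∘ transport p↦q) ⟩
  ∑ℕ (indicator p)                      ≡⟨ ∣∣≡sum p ⟨
  ∣ p ∣                                  ∎
  where
  open ≡-Reasoning
  open Sum +-0-commutativeMonoid using (sum-permute; sum-cong-≗) renaming (sum to ∑ℕ)
  toℕ : Bool → ℕ
  toℕ b = if b then 1 else 0
  indicator : ∀ {n} → Subset n → Fin n → ℕ
  indicator p i = toℕ (lookup p i)
  ∣∣≡sum : ∀ {n} (p : Subset n) → ∣ p ∣ ≡ ∑ℕ (indicator p)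
  ∣∣≡sum []          = refl
  ∣∣≡sum (true  ∷ p) = cong suc (∣∣≡sum p)
  ∣∣≡sum (false ∷ p) = ∣∣≡sum p

key : ∀ {m} → Vtx m → Vtx m → ℕ × ℕ × ℕ⁴
key y z = ∣ set y ∣ , ∣ set z ∣ , ϱ y z

module _ {m : ℕ} (σ : Aut m) (σ∈G : InG σ) where

  private
    σ⁻¹∈G : app⁻¹ σ (x₀ m) ≡ x₀ m
    σ⁻¹∈G = trans (cong (app⁻¹ σ) (sym σ∈G)) (app⁻¹-app σ (x₀ m))
    module σ   = PointImage (app σ) (D-app σ) σ∈G
    module σ⁻¹ = PointImage (app⁻¹ σ) (D-app⁻¹ σ) σ⁻¹∈G

    π π⁻¹ : Fin (S# m) → Fin (S# m)
    π   b = proj₁ (σ.point-image b)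
    π⁻¹ b = proj₁ (σ⁻¹.point-image b)

    π-image : ∀ u b → lookup (set (app σ u)) (π b) ≡ lookup (set u) b
    π-image u b = proj₂ (σ.point-image b) u
    π⁻¹-image : ∀ u b → lookup (set (app⁻¹ σ u)) (π⁻¹ b) ≡ lookup (set u) b
    π⁻¹-image u b = proj₂ (σ⁻¹.point-image b) u

  induced : Permutation (S# m) (S# m)
  induced = permutation π π⁻¹
    (λ b → points-separated (π (π⁻¹ b)) b λ v → begin
      lookup (set v) (π (π⁻¹ b))                   ≡⟨ cong (λ w → lookup (set w) (π (π⁻¹ b))) (app-app⁻¹ σ v) ⟨
      lookup (set (app σ (app⁻¹ σ v))) (π (π⁻¹ b)) ≡⟨ π-image (app⁻¹ σ v) (π⁻¹ b) ⟩
      lookup (set (app⁻¹ σ v)) (π⁻¹ b)             ≡⟨ π⁻¹-image v b ⟩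
      lookup (set v) b                             ∎)
    (λ b → points-separated (π⁻¹ (π b)) b λ v → begin
      lookup (set v) (π⁻¹ (π b))                   ≡⟨ cong (λ w → lookup (set w) (π⁻¹ (π b))) (app⁻¹-app σ v) ⟨
      lookup (set (app⁻¹ σ (app σ v))) (π⁻¹ (π b)) ≡⟨ π⁻¹-image (app σ v) (π b) ⟩
      lookup (set (app σ v)) (π b)                 ≡⟨ π-image v b ⟩
      lookup (set v) b                             ∎)
    where open ≡-Reasoning

  induced-transports : ∀ u → Transports induced (set u) (set (app σ u))
  induced-transports u = transports (π-image u)

  key-app : ∀ y z → key (app σ y) (app σ z) ≡ key y z
  key-app y z = cong₂ _,_ (∣∣ y↦) (cong₂ _,_ (∣∣ z↦) (cong₂ _,_ (∣∣ (∩ x₀↦ y↦)) (cong₂ _,_ (∣∣ (∩ x₀↦ z↦))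
                  (cong₂ _,_ (∣∣ (∩ y↦ z↦)) (∣∣ (∩ x₀↦ (∩ y↦ z↦)))))))
    where
    ∣∣ = transports-∣∣
    ∩  = transports-∩
    y↦ = induced-transports y
    z↦ = induced-transports z
    x₀↦ : Transports induced (x₀-set m) (x₀-set m)
    x₀↦ = subst (λ v → Transports induced (x₀-set m) (set v)) σ∈G (induced-transports (x₀ m))

-- Adjacent transpositions

swapAt : ℕ → Vec X n → Vec X n
swapAt zero    []          = []
swapAt zero    (x ∷ [])    = x ∷ []
swapAt zero    (x ∷ y ∷ v) = y ∷ x ∷ v
swapAt (suc k) []          = []
swapAt (suc k) (x ∷ v)     = x ∷ swapAt k v

swapAt-involutive : ∀ k (v : Vec X n) → swapAt k (swapAt k v) ≡ v
swapAt-involutive zero    []          = refl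
swapAt-involutive zero    (x ∷ [])    = refl
swapAt-involutive zero    (x ∷ y ∷ v) = refl
swapAt-involutive (suc k) []          = refl
swapAt-involutive (suc k) (x ∷ v)     = cong (x ∷_) (swapAt-involutive k v)

swapAt-zipWith : ∀ k (f : X → Y → Z) (u : Vec X n) (v : Vec Y n) →
                 swapAt k (zipWith f u v) ≡ zipWith f (swapAt k u) (swapAt k v)
swapAt-zipWith zero    f []          []          = refl
swapAt-zipWith zero    f (x ∷ [])    (y ∷ [])    = refl
swapAt-zipWith zero    f (x ∷ x′ ∷ u) (y ∷ y′ ∷ v) = refl
swapAt-zipWith (suc k) f []          []          = refl
swapAt-zipWith (suc k) f (x ∷ u)     (y ∷ v)     = cong (f x y ∷_) (swapAt-zipWith k f u v)

count-swapAt : ∀ {p} {P : Pred X p} (P? : Decidable P) k (v : Vec X n) → count P? (swapAt k v) ≡ count P? v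
count-swapAt P? zero    []          = refl
count-swapAt P? zero    (x ∷ [])    = refl
count-swapAt P? zero    (x ∷ y ∷ v) with does (P? x) | does (P? y)
... | true  | true  = refl
... | true  | false = refl
... | false | true  = refl
... | false | false = refl
count-swapAt P? (suc k) []          = refl
count-swapAt P? (suc k) (x ∷ v)     with does (P? x)
... | true  = cong suc (count-swapAt P? k v)
... | false = count-swapAt P? k v

swapAt-replicate : ∀ k (x : X) → swapAt k (replicate n x) ≡ replicate n x
swapAt-replicate {n = zero}        zero    x = refl
swapAt-replicate {n = suc zero}    zero    x = refl
swapAt-replicate {n = suc (suc n)} zero    x = refl
swapAt-replicate {n = zero}        (suc k) x = refl
swapAt-replicate {n = suc n}       (suc k) x = cong (x ∷_) (swapAt-replicate k x)

swapAt-++ˡ : ∀ k (u : Vec X m) (w : Vec X n) → suc k < m → swapAt k (u ++ w) ≡ swapAt k u ++ w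
swapAt-++ˡ zero    (x ∷ [])    w (s≤s ())
swapAt-++ˡ zero    (x ∷ y ∷ u) w _         = refl
swapAt-++ˡ (suc k) (x ∷ u)     w (s≤s k<m) = cong (x ∷_) (swapAt-++ˡ k u w k<m)

swapAt-++ʳ : ∀ k (u : Vec X m) (w : Vec X n) → swapAt (m + k) (u ++ w) ≡ u ++ swapAt k w
swapAt-++ʳ k []      w = refl
swapAt-++ʳ k (x ∷ u) w = cong (x ∷_) (swapAt-++ʳ k u w)

data Swap (P : ℕ → Set) {A : Set} {n : ℕ} : Vec A n → Vec A n → Set where
  swap : ∀ {k} → P k → (v : Vec A n) → Swap P v (swapAt k v)

InRange : ℕ → ℕ → Set
InRange n k = suc k < n

module _ {A : Set} (_≟_ : DecidableEquality A) where

  occurrences : A → Vec A n → ℕ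
  occurrences t = count (t ≟_)

  occurrences-Swaps : ∀ {P} {u v : Vec A n} → Star (Swap P) u v → ∀ t → occurrences t u ≡ occurrences t v
  occurrences-Swaps ε                 t = refl
  occurrences-Swaps (swap {k} _ u ◅ s) t = trans (sym (count-swapAt (t ≟_) k u)) (occurrences-Swaps s t)

  occurs-head : ∀ x (v : Vec A n) → 0 < occurrences x (x ∷ v)
  occurs-head x v with x ≟ x
  ... | yes _   = s≤s z≤n
  ... | no x≢x = ⊥-elim (x≢x refl)

  occurrences-tail : ∀ t {x} {u v : Vec A n} → occurrences t (x ∷ u) ≡ occurrences t (x ∷ v) →
                     occurrences t u ≡ occurrences t v
  occurrences-tail t {x} same with does (t ≟ x)
  ... | true  = suc-injective same
  ... | false = same

  prepend : ∀ {u v : Vec A n} x → Star (Swap (InRange n)) u v → Star (Swap (InRange (suc n))) (x ∷ u) (x ∷ v)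
  prepend x = gmap (x ∷_) λ { (swap k<n v) → swap (s≤s k<n) (x ∷ v) }

  bring-to-front : ∀ x (v : Vec A (suc n)) → 0 < occurrences x v →
                   ∃[ v′ ] Star (Swap (InRange (suc n))) (x ∷ v′) v
  bring-to-front x (y ∷ w) x∈v with x ≟ y
  ... | yes refl = w , ε
  bring-to-front {n = zero}  x (y ∷ []) () | no _
  bring-to-front {n = suc n} x (y ∷ w) x∈v | no _ with bring-to-front x w x∈v
  ... | w′ , x∷w′→w = y ∷ w′ , swap (s≤s (s≤s z≤n)) (x ∷ y ∷ w′) ◅ prepend y x∷w′→w

  sort-by-occurrences : (u v : Vec A n) → (∀ t → occurrences t u ≡ occurrences t v) → Star (Swap (InRange n)) u v
  sort-by-occurrences []      []      _    = ε
  sort-by-occurrences (x ∷ u) v       same with bring-to-front x v (subst (0 <_) (same x) (occurs-head x u))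
  ... | v′ , x∷v′→v = prepend x (sort-by-occurrences u v′ λ t →
          occurrences-tail t {x} {u} {v′} (trans (same t) (sym (occurrences-Swaps x∷v′→v t)))) ◅◅ x∷v′→v

-- Transpositions fixing x₀

Stable : ℕ → ℕ → Set
Stable m k = swapAt k (x₀-set m) ≡ x₀-set m

module _ {m : ℕ} (k : ℕ) where

  swapVtx : Vtx m → Vtx m
  swapVtx (vtx p p-size) = vtx (swapAt k p) (subst (IsSize m) (sym (count-swapAt (_≟ᵇ true) k p)) p-size)

  swapVtx-involutive : ∀ x → swapVtx (swapVtx x) ≡ x
  swapVtx-involutive x = vtx-≡ (swapAt-involutive k (set x))

  D-swapVtx : ∀ x y → D (swapVtx x) (swapVtx y) ≡ D x y
  D-swapVtx x y = trans (cong ∣_∣ (sym (swapAt-zipWith k _xor_ (set x) (set y))))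
                        (count-swapAt (_≟ᵇ true) k (zipWith _xor_ (set x) (set y)))

  swapVtx-Adj : ∀ x y → Adj x y → Adj (swapVtx x) (swapVtx y)
  swapVtx-Adj x y x~y = D≡1⇒Adj (swapVtx x) (swapVtx y) (trans (D-swapVtx x y) (Adj⇒D≡1 x y x~y))

  swapAut : Aut m
  swapAut = record
    { perm    = mk↔ₛ′ swapVtx swapVtx swapVtx-involutive swapVtx-involutive
    ; adj-iff = λ x y → mk⇔ (swapVtx-Adj x y)
                  (subst₂ Adj (swapVtx-involutive x) (swapVtx-involutive y) ∘ swapVtx-Adj (swapVtx x) (swapVtx y))
    }

  swapAut∈G : Stable m k → InG swapAut
  swapAut∈G = vtx-≡

pairs : Vtx m → Vtx m → Vec (Bool × Bool) (S# m)
pairs y z = zip (set y) (set z)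

pairs-injective : ∀ {y z y′ z′ : Vtx m} → pairs y z ≡ pairs y′ z′ → y ≡ y′ × z ≡ z′
pairs-injective {y = y} {z} {y′} {z′} same =
  vtx-≡ (cong proj₁ unzipped) , vtx-≡ (cong proj₂ unzipped)
  where
  unzipped : (set y , set z) ≡ (set y′ , set z′)
  unzipped = trans (sym (unzip∘zip (set y) (set z))) (trans (cong unzip same) (unzip∘zip (set y′) (set z′)))

module _ {c ℓ} (F : Field c ℓ) {B : Mat F m} (B∈𝒜 : InCentralizer F B) where
  open Field F using (_≈_) renaming (refl to ≈-refl; sym to ≈-sym; trans to ≈-trans)

  constant-along-swaps : ∀ {W W′} → Star (Swap (Stable m)) W W′ →
                         ∀ {y z y′ z′} → pairs y z ≡ W → pairs y′ z′ ≡ W′ → B y z ≈ B y′ z′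
  constant-along-swaps ε {y} {z} {y′} {z′} yz↦W y′z′↦W
    with refl , refl ← pairs-injective {y = y} {z} {y′} {z′} (trans yz↦W (sym y′z′↦W)) = ≈-refl
  constant-along-swaps (swap {k} stable W ◅ rest) {y} {z} yz↦W y′z′↦W′ =
    ≈-trans (≈-sym (B∈𝒜 (swapAut k) (swapAut∈G k stable) y z))
          (constant-along-swaps rest (trans (sym (swapAt-zipWith k _,_ (set y) (set z))) (cong (swapAt k) yz↦W)) y′z′↦W′)

stable-inside : ∀ {k} → suc k < m → Stable m k
stable-inside {m} {k} k<m = trans (swapAt-++ˡ k (replicate m inside) (replicate (suc m) outside) k<m)
                                  (cong (_++ replicate (suc m) outside) (swapAt-replicate k inside))

stable-outside : ∀ k → Stable m (m + k)
stable-outside {m} k = trans (swapAt-++ʳ k (replicate m inside) (replicate (suc m) outside))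
                             (cong (replicate m inside ++_) (swapAt-replicate k outside))

module _ {A : Set} where

  swaps-inside : ∀ {L L′ : Vec A m} (R : Vec A (suc m)) → Star (Swap (InRange m)) L L′ → Star (Swap (Stable m)) (L ++ R) (L′ ++ R)
  swaps-inside R = gmap (_++ R) λ { (swap {k} k<m L) →
    subst (Swap (Stable _) (L ++ R)) (swapAt-++ˡ k L R k<m) (swap (stable-inside k<m) (L ++ R)) }

  swaps-outside : ∀ (L : Vec A m) {R R′ : Vec A (suc m)} → Star (Swap (InRange (suc m))) R R′ → Star (Swap (Stable m)) (L ++ R) (L ++ R′)
  swaps-outside {m} L = gmap (L ++_) λ { (swap {k} _ R) →
    subst (Swap (Stable m) (L ++ R)) (swapAt-++ʳ k L R) (swap (stable-outside k) (L ++ R)) }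

-- Regions of a pair of vertices

_≟²_ : DecidableEquality (Bool × Bool)
_≟²_ = ≡-dec _≟ᵇ_ _≟ᵇ_

record Tally : Set where
  constructor tally
  field both only-y only-z neither : ℕ
open Tally public

tallyOf : Vec (Bool × Bool) n → Tally
tallyOf W = tally (occ (true , true)) (occ (true , false)) (occ (false , true)) (occ (false , false))
  where occ = λ t → occurrences _≟²_ t W

total : Tally → ℕ
total (tally a b c d) = a + b + c + d

total-tallyOf : (W : Vec (Bool × Bool) n) → total (tallyOf W) ≡ n
total-tallyOf [] = refl
total-tallyOf ((true  , true ) ∷ W) = cong suc (total-tallyOf W)
total-tallyOf ((true  , false) ∷ W) = trans (step (both T) (only-y T) (only-z T) (neither T)) (cong suc (total-tallyOf W))
  where
  T = tallyOf W
  step : ∀ a b c d → a + suc b + c + d ≡ suc (a + b + c + d)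
  step = solve-∀
total-tallyOf ((false , true ) ∷ W) = trans (step (both T) (only-y T) (only-z T) (neither T)) (cong suc (total-tallyOf W))
  where
  T = tallyOf W
  step : ∀ a b c d → a + b + suc c + d ≡ suc (a + b + c + d)
  step = solve-∀
total-tallyOf ((false , false) ∷ W) = trans (+-suc _ _) (cong suc (total-tallyOf W))

∣map-proj₁∣ : (W : Vec (Bool × Bool) n) → ∣ map proj₁ W ∣ ≡ both (tallyOf W) + only-y (tallyOf W)
∣map-proj₁∣ [] = refl
∣map-proj₁∣ ((true  , true ) ∷ W) = cong suc (∣map-proj₁∣ W)
∣map-proj₁∣ ((true  , false) ∷ W) = trans (cong suc (∣map-proj₁∣ W)) (sym (+-suc _ _))
∣map-proj₁∣ ((false , true ) ∷ W) = ∣map-proj₁∣ W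
∣map-proj₁∣ ((false , false) ∷ W) = ∣map-proj₁∣ W

∣map-proj₂∣ : (W : Vec (Bool × Bool) n) → ∣ map proj₂ W ∣ ≡ both (tallyOf W) + only-z (tallyOf W)
∣map-proj₂∣ [] = refl
∣map-proj₂∣ ((true  , true ) ∷ W) = cong suc (∣map-proj₂∣ W)
∣map-proj₂∣ ((true  , false) ∷ W) = ∣map-proj₂∣ W
∣map-proj₂∣ ((false , true ) ∷ W) = trans (cong suc (∣map-proj₂∣ W)) (sym (+-suc _ _))
∣map-proj₂∣ ((false , false) ∷ W) = ∣map-proj₂∣ W

∣map-∧∣ : (W : Vec (Bool × Bool) n) → ∣ map (uncurry _∧_) W ∣ ≡ both (tallyOf W)
∣map-∧∣ [] = refl
∣map-∧∣ ((true  , true ) ∷ W) = cong suc (∣map-∧∣ W)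
∣map-∧∣ ((true  , false) ∷ W) = ∣map-∧∣ W
∣map-∧∣ ((false , true ) ∷ W) = ∣map-∧∣ W
∣map-∧∣ ((false , false) ∷ W) = ∣map-∧∣ W

∣++∣ : ∀ {k} (u : Subset n) (v : Subset k) → ∣ u ++ v ∣ ≡ ∣ u ∣ + ∣ v ∣
∣++∣ []          v = refl
∣++∣ (true  ∷ u) v = cong suc (∣++∣ u v)
∣++∣ (false ∷ u) v = ∣++∣ u v

∣x₀∩∣ : (u : Subset m) (v : Subset (suc m)) → ∣ x₀-set m ∩ (u ++ v) ∣ ≡ ∣ u ∣
∣x₀∩∣ u v = go u v
  where
  go : ∀ {i k} (u : Subset i) (v : Subset k) → ∣ (replicate i inside ++ replicate k outside) ∩ (u ++ v) ∣ ≡ ∣ u ∣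
  go []          []          = refl
  go []          (_ ∷ v)     = go [] v
  go (true  ∷ u) v           = cong suc (go u v)
  go (false ∷ u) v           = go u v

zipWith-via-zip : (f : X → Y → Z) (u : Vec X n) (v : Vec Y n) → zipWith f u v ≡ map (uncurry f) (zip u v)
zipWith-via-zip f []      []      = refl
zipWith-via-zip f (x ∷ u) (y ∷ v) = cong (f x y ∷_) (zipWith-via-zip f u v)

keyOf : Tally → Tally → ℕ × ℕ × ℕ⁴
keyOf (tally l₁ l₂ l₃ l₄) (tally r₁ r₂ r₃ r₄) =
  l₁ + l₂ + (r₁ + r₂) , l₁ + l₃ + (r₁ + r₃) , l₁ + l₂ , l₁ + l₃ , l₁ + r₁ , l₁

subsetKey : (p q : Subset (S# m)) → ℕ × ℕ × ℕ⁴
subsetKey {m} p q = ∣ p ∣ , ∣ q ∣ , ∣ x₀-set m ∩ p ∣ , ∣ x₀-set m ∩ q ∣ , ∣ p ∩ q ∣ , ∣ x₀-set m ∩ p ∩ q ∣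

key-of-parts : (p q : Subset (S# m)) (L : Vec (Bool × Bool) m) (R : Vec (Bool × Bool) (suc m)) →
               zip p q ≡ L ++ R → subsetKey p q ≡ keyOf (tallyOf L) (tallyOf R)
key-of-parts {m} p q L R pq≡L++R =
  cong₂ _,_ (trans (cong ∣_∣ p≡) (trans (∣++∣ (map proj₁ L) _) (cong₂ _+_ (∣map-proj₁∣ L) (∣map-proj₁∣ R))))
  (cong₂ _,_ (trans (cong ∣_∣ q≡) (trans (∣++∣ (map proj₂ L) _) (cong₂ _+_ (∣map-proj₂∣ L) (∣map-proj₂∣ R))))
  (cong₂ _,_ (trans (cong (∣_∣ ∘ (x₀-set m ∩_)) p≡) (trans (∣x₀∩∣ (map proj₁ L) _) (∣map-proj₁∣ L)))
  (cong₂ _,_ (trans (cong (∣_∣ ∘ (x₀-set m ∩_)) q≡) (trans (∣x₀∩∣ (map proj₂ L) _) (∣map-proj₂∣ L)))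
  (cong₂ _,_ (trans (cong ∣_∣ p∩q≡) (trans (∣++∣ (map ∧-pair L) _) (cong₂ _+_ (∣map-∧∣ L) (∣map-∧∣ R))))
             (trans (cong (∣_∣ ∘ (x₀-set m ∩_)) p∩q≡) (trans (∣x₀∩∣ (map ∧-pair L) _) (∣map-∧∣ L)))))))
  where
  ∧-pair = uncurry _∧_
  p≡ : p ≡ map proj₁ L ++ map proj₁ R
  p≡ = trans (sym (map-proj₁-zip p q)) (trans (cong (map proj₁) pq≡L++R) (map-++ proj₁ L R))
  q≡ : q ≡ map proj₂ L ++ map proj₂ R
  q≡ = trans (sym (map-proj₂-zip p q)) (trans (cong (map proj₂) pq≡L++R) (map-++ proj₂ L R))
  p∩q≡ : p ∩ q ≡ map ∧-pair L ++ map ∧-pair R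
  p∩q≡ = trans (zipWith-via-zip _∧_ p q) (trans (cong (map ∧-pair) pq≡L++R) (map-++ ∧-pair L R))

tallyOf-≡⇒occurrences : {W W′ : Vec (Bool × Bool) n} → tallyOf W ≡ tallyOf W′ →
                        ∀ t → occurrences _≟²_ t W ≡ occurrences _≟²_ t W′
tallyOf-≡⇒occurrences same (true  , true ) = cong both same
tallyOf-≡⇒occurrences same (true  , false) = cong only-y same
tallyOf-≡⇒occurrences same (false , true ) = cong only-z same
tallyOf-≡⇒occurrences same (false , false) = cong neither same

module _ {m : ℕ} (y z : Vtx m) where

  private
    split = splitAt m (pairs y z)

  inner-pairs : Vec (Bool × Bool) m
  inner-pairs = proj₁ split

  outer-pairs : Vec (Bool × Bool) (suc m)
  outer-pairs = proj₁ (proj₂ split)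

  pairs≡inner++outer : pairs y z ≡ inner-pairs ++ outer-pairs
  pairs≡inner++outer = proj₂ (proj₂ split)

  regions : Tally × Tally
  regions = tallyOf inner-pairs , tallyOf outer-pairs

  key≡keyOf-regions : key y z ≡ keyOf (tallyOf inner-pairs) (tallyOf outer-pairs)
  key≡keyOf-regions = key-of-parts (set y) (set z) inner-pairs outer-pairs pairs≡inner++outer

module _ {c ℓ} (F : Field c ℓ) {m} {B : Mat F m} (B∈𝒜 : InCentralizer F B) where
  open Field F using (_≈_)

  constant-on-regions : ∀ {y z y′ z′ : Vtx m} → regions y z ≡ regions y′ z′ → B y z ≈ B y′ z′
  constant-on-regions {y} {z} {y′} {z′} same =
    constant-along-swaps F B∈𝒜 (swaps-inside (outer-pairs y z) sort-inner ◅◅ swaps-outside (inner-pairs y′ z′) sort-outer)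
                               (pairs≡inner++outer y z) (pairs≡inner++outer y′ z′)
    where
    sort-inner = sort-by-occurrences _≟²_ (inner-pairs y z) (inner-pairs y′ z′)
                   (tallyOf-≡⇒occurrences {W = inner-pairs y z} {inner-pairs y′ z′} (cong proj₁ same))
    sort-outer = sort-by-occurrences _≟²_ (outer-pairs y z) (outer-pairs y′ z′)
                   (tallyOf-≡⇒occurrences {W = outer-pairs y z} {outer-pairs y′ z′} (cong proj₂ same))

fromKey : ℕ → ℕ × ℕ × ℕ⁴ → Tally × Tally
fromKey m (a , b , i , j , t , p) =
  tally p l₂ l₃ (m ∸ (i + l₃)) , tally r₁ (a ∸ i ∸ r₁) (b ∸ j ∸ r₁) (suc m ∸ (a ∸ i + (b ∸ j ∸ r₁)))
  where
  l₂ = i ∸ p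
  l₃ = j ∸ p
  r₁ = t ∸ p

fromKey-keyOf : ∀ l r → total l ≡ m → total r ≡ suc m → fromKey m (keyOf l r) ≡ (l , r)
fromKey-keyOf (tally l₁ l₂ l₃ l₄) (tally r₁ r₂ r₃ r₄) refl r-total
  rewrite m+n∸m≡n l₁ l₂ | m+n∸m≡n l₁ l₃ | m+n∸m≡n l₁ r₁
        | m+n∸m≡n (l₁ + l₂) (r₁ + r₂) | m+n∸m≡n (l₁ + l₃) (r₁ + r₃) | m+n∸m≡n r₁ r₂ | m+n∸m≡n r₁ r₃
        | m+n∸m≡n (l₁ + l₂ + l₃) l₄ | sym r-total | +-assoc r₁ r₂ r₃ | m+n∸m≡n (r₁ + (r₂ + r₃)) r₄ = refl

fill : ∀ n → Tally → Vec (Bool × Bool) n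
fill zero    _                              = []
fill (suc n) (tally (suc a) b c d)          = (true  , true ) ∷ fill n (tally a b c d)
fill (suc n) (tally zero (suc b) c d)       = (true  , false) ∷ fill n (tally zero b c d)
fill (suc n) (tally zero zero (suc c) d)    = (false , true ) ∷ fill n (tally zero zero c d)
fill (suc n) (tally zero zero zero d)       = (false , false) ∷ fill n (tally zero zero zero (d ∸ 1))

tallyOf-fill : ∀ n t → total t ≡ n → tallyOf (fill n t) ≡ t
tallyOf-fill zero    (tally zero zero zero zero) refl = refl
tallyOf-fill (suc n) (tally (suc a) b c d) e =
  cong (λ { (tally a b c d) → tally (suc a) b c d }) (tallyOf-fill n (tally a b c d) (suc-injective e))
tallyOf-fill (suc n) (tally zero (suc b) c d) e =
  cong (λ { (tally a b c d) → tally a (suc b) c d }) (tallyOf-fill n (tally zero b c d) (suc-injective e))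
tallyOf-fill (suc n) (tally zero zero (suc c) d) e =
  cong (λ { (tally a b c d) → tally a b (suc c) d }) (tallyOf-fill n (tally zero zero c d) (suc-injective e))
tallyOf-fill (suc n) (tally zero zero zero (suc d)) e =
  cong (λ { (tally a b c d) → tally a b c (suc d) }) (tallyOf-fill n (tally zero zero zero d) (suc-injective e))

Valid : ℕ → Tally × Tally → Set
Valid m (l , r) = total l ≡ m × total r ≡ suc m × IsSize m (proj₁ κ) × IsSize m (proj₁ (proj₂ κ))
  where κ = keyOf l r

record Region (m : ℕ) : Set where
  constructor region
  field
    tallies : Tally × Tally
    .valid  : Valid m tallies
open Region public

region-≡ : {R R′ : Region m} → tallies R ≡ tallies R′ → R ≡ R′
region-≡ refl = refl

regions-valid : (y z : Vtx m) → Valid m (regions y z)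
regions-valid y z = total-tallyOf (inner-pairs y z) , total-tallyOf (outer-pairs y z) ,
  subst (IsSize _) (cong proj₁ (key≡keyOf-regions y z)) (vertex-size y) ,
  subst (IsSize _) (cong (proj₁ ∘ proj₂) (key≡keyOf-regions y z)) (vertex-size z)

fromKey-key : (y z : Vtx m) → fromKey m (key y z) ≡ regions y z
fromKey-key y z = trans (cong (fromKey _) (key≡keyOf-regions y z))
                        (fromKey-keyOf _ _ (total-tallyOf (inner-pairs y z)) (total-tallyOf (outer-pairs y z)))

zip-map-proj : (W : Vec (Bool × Bool) n) → zip (map proj₁ W) (map proj₂ W) ≡ W
zip-map-proj []      = refl
zip-map-proj (w ∷ W) = cong (w ∷_) (zip-map-proj W)

module Witness {m} (l r : Tally) .(v : Valid m (l , r)) where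

  private
    l-total : total l ≡ m
    l-total = recompute (total l ≟ m) (proj₁ v)
    r-total : total r ≡ suc m
    r-total = recompute (total r ≟ suc m) (proj₁ (proj₂ v))
    W = fill m l ++ fill (suc m) r
    key-W : subsetKey (map proj₁ W) (map proj₂ W) ≡ keyOf l r
    key-W = trans (key-of-parts _ _ (fill m l) (fill (suc m) r) (zip-map-proj W))
                  (cong₂ keyOf (tallyOf-fill m l l-total) (tallyOf-fill (suc m) r r-total))

  witnessʸ witnessᶻ : Vtx m
  witnessʸ = vtx (map proj₁ W) (subst (IsSize m) (sym (cong proj₁ key-W)) (proj₁ (proj₂ (proj₂ v))))
  witnessᶻ = vtx (map proj₂ W) (subst (IsSize m) (sym (cong (proj₁ ∘ proj₂) key-W)) (proj₂ (proj₂ (proj₂ v))))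

  key-witness : key witnessʸ witnessᶻ ≡ keyOf l r
  key-witness = key-W

  regions-witness : regions witnessʸ witnessᶻ ≡ (l , r)
  regions-witness = cong₂ _,_
    (trans (cong tallyOf (proj₁ split-W)) (tallyOf-fill m l l-total))
    (trans (cong tallyOf (proj₂ split-W)) (tallyOf-fill (suc m) r r-total))
    where
    split-W = ++-injective (inner-pairs witnessʸ witnessᶻ) (fill m l)
                (trans (sym (pairs≡inner++outer witnessʸ witnessᶻ)) (zip-map-proj W))

keyIdx : Idx m → ℕ × ℕ × ℕ⁴
keyIdx (idx a b q _ _ _) = a , b , q

idx-≡ : {x x′ : Idx m} → keyIdx x ≡ keyIdx x′ → x ≡ x′
idx-≡ {x = idx _ _ _ _ _ _} {idx _ _ _ _ _ _} refl = refl

_≟ᵏ_ : DecidableEquality (ℕ × ℕ × ℕ⁴)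
(a , b , i , j , t , p) ≟ᵏ (a′ , b′ , i′ , j′ , t′ , p′) =
  map′ (λ { (refl , refl , refl , refl , refl , refl) → refl }) (λ { refl → refl , refl , refl , refl , refl , refl })
       (a ≟ a′ ×-dec b ≟ b′ ×-dec i ≟ i′ ×-dec j ≟ j′ ×-dec t ≟ t′ ×-dec p ≟ p′)

private
  key≡ : ∀ {y z : Vtx m} {a b q} → ∣ set y ∣ ≡ a × ∣ set z ∣ ≡ b × ϱ y z ≡ q → key y z ≡ (a , b , q)
  key≡ (refl , refl , refl) = refl

  Realizes : ℕ → ℕ × ℕ × ℕ⁴ → Set
  Realizes m (a , b , q) = ∃[ y ] ∃[ z ] (∣ set y ∣ ≡ a × ∣ set z ∣ ≡ b × ϱ {m} y z ≡ q)

  valid-realized : ∀ κ → Realizes m κ → Valid m (fromKey m κ)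
  valid-realized κ (y , z , y,z∈) = subst (Valid _) (trans (sym (fromKey-key y z)) (cong (fromKey _) (key≡ {y = y} {z} y,z∈))) (regions-valid y z)

  keyOf-fromKey : ∀ κ → Realizes m κ → uncurry keyOf (fromKey m κ) ≡ κ
  keyOf-fromKey κ (y , z , y,z∈) =
    trans (cong (uncurry keyOf) (trans (cong (fromKey _) (sym (key≡ {y = y} {z} y,z∈))) (fromKey-key y z)))
          (trans (sym (key≡keyOf-regions y z)) (key≡ {y = y} {z} y,z∈))

-- the pair realizing an index is irrelevant, so its region is computed from the key
toRegion : Idx m → Region m
toRegion {m} (idx a b q _ _ realized) = region (fromKey m (a , b , q)) (valid-realized _ realized)

fromRegion : Region m → Idx m
fromRegion (region (l , r) v) = idx a b q (proj₁ (proj₂ (proj₂ v))) (proj₂ (proj₂ (proj₂ v)))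
  (witnessʸ , witnessᶻ , cong proj₁ key-witness , cong (proj₁ ∘ proj₂) key-witness , cong (proj₂ ∘ proj₂) key-witness)
  where
  open Witness l r v
  a = proj₁ (keyOf l r)
  b = proj₁ (proj₂ (keyOf l r))
  q = proj₂ (proj₂ (keyOf l r))

Idx↔Region : Idx m ↔ Region m
Idx↔Region {m} = mk↔ₛ′ toRegion fromRegion to∘from from∘to
  where
  to∘from : ∀ R → toRegion (fromRegion R) ≡ R
  to∘from (region (l , r) v) = region-≡ (fromKey-keyOf l r (recompute (total l ≟ m) (proj₁ v))
                                                           (recompute (total r ≟ suc m) (proj₁ (proj₂ v))))
  from∘to : ∀ x → fromRegion (toRegion x) ≡ x
  from∘to (idx a b q _ _ realized) = idx-≡ (recompute (_ ≟ᵏ _) (keyOf-fromKey _ realized))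

idxOf : (y z : Vtx m) → Idx m
idxOf y z = idx ∣ set y ∣ ∣ set z ∣ (ϱ y z) (vertex-size y) (vertex-size z) (y , z , refl , refl , refl)

witnessOf : Region m → Vtx m × Vtx m
witnessOf (region (l , r) v) = Witness.witnessʸ l r v , Witness.witnessᶻ l r v

key-witnessOf : (R : Region m) → key (proj₁ (witnessOf R)) (proj₂ (witnessOf R)) ≡ uncurry keyOf (tallies R)
key-witnessOf (region (l , r) v) = Witness.key-witness l r v

regions-witnessOf : (R : Region m) → regions (proj₁ (witnessOf R)) (proj₂ (witnessOf R)) ≡ tallies R
regions-witnessOf (region (l , r) v) = Witness.regions-witness l r v

witness : Idx m → Vtx m × Vtx m
witness x = witnessOf (toRegion x)

key-witness : (x : Idx m) → key (proj₁ (witness x)) (proj₂ (witness x)) ≡ keyIdx x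
key-witness x@(idx _ _ _ _ _ realized) = trans (key-witnessOf (toRegion x)) (recompute (_ ≟ᵏ _) (keyOf-fromKey _ realized))

regions-witness-idxOf : (y z : Vtx m) → regions (proj₁ (witness (idxOf y z))) (proj₂ (witness (idxOf y z))) ≡ regions y z
regions-witness-idxOf y z = trans (regions-witnessOf (toRegion (idxOf y z))) (fromKey-key y z)

-- Counting regions

zigzag : ℤ → ℕ
zigzag (ℤ.+ u)     = u + u
zigzag -[1+ u ] = suc (u + u)

private
  away : ℤ → ℤ
  away (ℤ.+ u)     = ℤ.+ suc u
  away -[1+ u ] = -[1+ suc u ]

unzigzag : ℕ → ℤ
unzigzag zero          = ℤ.+ 0
unzigzag (suc zero)    = -[1+ 0 ]
unzigzag (suc (suc k)) = away (unzigzag k)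

zigzag-unzigzag : ∀ k → zigzag (unzigzag k) ≡ k
zigzag-unzigzag zero          = refl
zigzag-unzigzag (suc zero)    = refl
zigzag-unzigzag (suc (suc k)) = trans (zigzag-away (unzigzag k)) (cong (2 +_) (zigzag-unzigzag k))
  where
  zigzag-away : ∀ s → zigzag (away s) ≡ suc (suc (zigzag s))
  zigzag-away (ℤ.+ u)     = cong suc (+-suc u u)
  zigzag-away -[1+ u ] = cong (2 +_) (+-suc u u)

unzigzag-zigzag : ∀ s → unzigzag (zigzag s) ≡ s
unzigzag-zigzag (ℤ.+ zero)          = refl
unzigzag-zigzag (ℤ.+ suc u)         = trans (cong (λ k → unzigzag (suc k)) (+-suc u u)) (cong away (unzigzag-zigzag (ℤ.+ u)))
unzigzag-zigzag -[1+ zero ]      = refl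
unzigzag-zigzag -[1+ suc u ]     = trans (cong (λ k → unzigzag (suc (suc k))) (+-suc u u)) (cong away (unzigzag-zigzag -[1+ u ]))

bit : Bool → ℕ
bit false = 0
bit true  = 1

pos neg : ℤ → ℕ
pos (ℤ.+ p)     = p
pos -[1+ n ] = 0
neg (ℤ.+ p)     = 0
neg -[1+ n ] = suc n

-- Pair the inner count of each type (both, only y, only z, neither) with the outer
-- count of the complementary type.  When ∣y∣ = m + bit α and ∣z∣ = m + bit β, the
-- outer-minus-inner differences of the four pairs are 1 − α − β + s, β − s, α − s and s
-- for an integer s; excessOf lists their negative and their positive parts.
excessOf : Bool → Bool → ℤ → Tally × Tally
excessOf α β s = tally (bit α + bit β + s⁻ ∸ suc s⁺) (s⁺ ∸ (bit β + s⁻)) (s⁺ ∸ (bit α + s⁻)) s⁻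
               , tally (suc s⁺ ∸ (bit α + bit β + s⁻)) (bit β + s⁻ ∸ s⁺) (bit α + s⁻ ∸ s⁺) s⁺
  where
  s⁺ = pos s
  s⁻ = neg s

recentre : Bool → Bool → ℤ → ℤ
recentre false false s = s
recentre true  true  s = pred s
recentre true  false s = - s
recentre false true  s = - s

uncentre : Bool → Bool → ℤ → ℤ
uncentre false false s = s
uncentre true  true  s = sucℤ s
uncentre true  false s = - s
uncentre false true  s = - s

uncentre-recentre : ∀ α β s → uncentre α β (recentre α β s) ≡ s
uncentre-recentre false false s = refl
uncentre-recentre true  true  s = sucℤ-pred s
uncentre-recentre true  false s = neg-involutive s
uncentre-recentre false true  s = neg-involutive s

recentre-uncentre : ∀ α β s → recentre α β (uncentre α β s) ≡ s
recentre-uncentre false false s = refl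
recentre-uncentre true  true  s = pred-sucℤ s
recentre-uncentre true  false s = neg-involutive s
recentre-uncentre false true  s = neg-involutive s

private
  lemma₁ : ∀ n → n + 0 + 0 + suc n ≡ suc (n + n)
  lemma₁ = solve-∀
  lemma₂ : ∀ n → suc (suc n) + 0 + 0 + suc n ≡ suc (suc n + suc n)
  lemma₂ = solve-∀
  lemma₃ : ∀ n → suc n + 0 + 0 + suc n ≡ suc n + suc n
  lemma₃ = solve-∀

deficit-zigzag : ∀ α β s → total (proj₁ (excessOf α β s)) ≡ zigzag (recentre α β s)
deficit-zigzag false false (ℤ.+ p)          = +-identityʳ (p + p)
deficit-zigzag false false -[1+ n ]      = lemma₁ n
deficit-zigzag true  true  (ℤ.+ zero)       = refl
deficit-zigzag true  true  (ℤ.+ suc p)      = trans (cong (λ d → d + p + p + 0) (0∸n≡0 p)) (+-identityʳ (p + p))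
deficit-zigzag true  true  -[1+ n ]      = lemma₂ n
deficit-zigzag true  false (ℤ.+ zero)       = refl
deficit-zigzag true  false (ℤ.+ suc p)      = +-identityʳ (suc (p + p))
deficit-zigzag true  false -[1+ n ]      = lemma₃ n
deficit-zigzag false true  (ℤ.+ zero)       = refl
deficit-zigzag false true  (ℤ.+ suc p)      = trans (+-identityʳ (p + suc p)) (+-suc p p)
deficit-zigzag false true  -[1+ n ]      = lemma₃ n

assemble : Tally → Tally × Tally → Tally × Tally
assemble (tally c₁ c₂ c₃ c₄) (tally d₁ d₂ d₃ d₄ , tally e₁ e₂ e₃ e₄) =
  tally (c₁ + d₁) (c₂ + d₂) (c₃ + d₃) (c₄ + d₄) , tally (c₄ + e₄) (c₃ + e₃) (c₂ + e₂) (c₁ + e₁)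

common : Tally × Tally → Tally
common (tally l₁ l₂ l₃ l₄ , tally r₁ r₂ r₃ r₄) = tally (l₁ ⊓ r₄) (l₂ ⊓ r₃) (l₃ ⊓ r₂) (l₄ ⊓ r₁)

excesses : Tally × Tally → Tally × Tally
excesses (tally l₁ l₂ l₃ l₄ , tally r₁ r₂ r₃ r₄) =
  tally (l₁ ∸ r₄) (l₂ ∸ r₃) (l₃ ∸ r₂) (l₄ ∸ r₁) , tally (r₄ ∸ l₁) (r₃ ∸ l₂) (r₂ ∸ l₃) (r₁ ∸ l₄)

Orthogonal : Tally × Tally → Set
Orthogonal (tally d₁ d₂ d₃ d₄ , tally e₁ e₂ e₃ e₄) = d₁ ⊓ e₁ ≡ 0 × d₂ ⊓ e₂ ≡ 0 × d₃ ⊓ e₃ ≡ 0 × d₄ ⊓ e₄ ≡ 0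

offset : Tally × Tally → ℤ
offset (tally _ _ _ d₄ , tally _ _ _ e₄) = e₄ ⊖ d₄

Balanced : Bool → Bool → Tally × Tally → Set
Balanced α β (tally d₁ d₂ d₃ d₄ , tally e₁ e₂ e₃ e₄) =
  e₁ + e₂ + e₃ + e₄ ≡ suc (d₁ + d₂ + d₃ + d₄) × e₄ + e₃ ≡ d₃ + d₄ + bit α × e₄ + e₂ ≡ d₂ + d₄ + bit β

private
  split-pair : ∀ x y → x ≡ x ⊓ y + (x ∸ y) × y ≡ x ⊓ y + (y ∸ x)
  split-pair x y = trans (sym (m⊓n+n∸m≡n y x)) (cong (_+ (x ∸ y)) (⊓-comm y x)) , sym (m⊓n+n∸m≡n x y)

  ∸-balanced : ∀ x y → (y ∸ x) + x ≡ (x ∸ y) + y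
  ∸-balanced zero    zero    = refl
  ∸-balanced zero    (suc y) = +-identityʳ (suc y)
  ∸-balanced (suc x) zero    = sym (+-identityʳ (suc x))
  ∸-balanced (suc x) (suc y) = trans (+-suc (y ∸ x) x) (trans (cong suc (∸-balanced x y)) (sym (+-suc (x ∸ y) y)))

  orthogonal-balanced : ∀ {d e} A B → d ⊓ e ≡ 0 → e + A ≡ d + B → d ≡ A ∸ B × e ≡ B ∸ A
  orthogonal-balanced {zero}  {e}     A B _  e+A≡B = sym (m≤n⇒m∸n≡0 (subst (A ≤_) e+A≡B (m≤n+m A e))) ,
                                                     sym (trans (cong (_∸ A) (sym e+A≡B)) (m+n∸n≡m e A))
  orthogonal-balanced {suc d} {zero}  A B _  A≡d+B = sym (trans (cong (_∸ B) A≡d+B) (m+n∸n≡m (suc d) B)) ,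
                                                     sym (m≤n⇒m∸n≡0 (subst (B ≤_) (sym A≡d+B) (m≤n+m B (suc d))))

excesses-orthogonal : ∀ R → Orthogonal (excesses R)
excesses-orthogonal (tally l₁ l₂ l₃ l₄ , tally r₁ r₂ r₃ r₄) =
  [m∸n]⊓[n∸m]≡0 l₁ r₄ , [m∸n]⊓[n∸m]≡0 l₂ r₃ , [m∸n]⊓[n∸m]≡0 l₃ r₂ , [m∸n]⊓[n∸m]≡0 l₄ r₁

tally-cong : ∀ {a b c d a′ b′ c′ d′} → a ≡ a′ → b ≡ b′ → c ≡ c′ → d ≡ d′ → tally a b c d ≡ tally a′ b′ c′ d′
tally-cong refl refl refl refl = refl

assemble-common-excesses : ∀ R → assemble (common R) (excesses R) ≡ R
assemble-common-excesses (tally l₁ l₂ l₃ l₄ , tally r₁ r₂ r₃ r₄) = cong₂ _,_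
  (tally-cong (sym (proj₁ (split-pair l₁ r₄))) (sym (proj₁ (split-pair l₂ r₃)))
              (sym (proj₁ (split-pair l₃ r₂))) (sym (proj₁ (split-pair l₄ r₁))))
  (tally-cong (sym (proj₂ (split-pair l₄ r₁))) (sym (proj₂ (split-pair l₃ r₂)))
              (sym (proj₂ (split-pair l₂ r₃))) (sym (proj₂ (split-pair l₁ r₄))))

private
  min-orthogonal : ∀ c {d e} → d ⊓ e ≡ 0 → (c + d) ⊓ (c + e) ≡ c
  min-orthogonal c {d} {e} d⊓e≡0 = trans (sym (+-distribˡ-⊓ c d e)) (trans (cong (λ x → c + x) d⊓e≡0) (+-identityʳ c))

  ∸-orthogonal : ∀ c {d e} → d ⊓ e ≡ 0 → (c + d) ∸ (c + e) ≡ d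
  ∸-orthogonal c {d}     {zero}  _ = trans ([m+n]∸[m+o]≡n∸o c d 0) refl
  ∸-orthogonal c {zero}  {suc e} _ = trans ([m+n]∸[m+o]≡n∸o c 0 (suc e)) refl

common-assemble : ∀ c E → Orthogonal E → common (assemble c E) ≡ c
common-assemble (tally c₁ c₂ c₃ c₄) (tally d₁ d₂ d₃ d₄ , tally e₁ e₂ e₃ e₄) (o₁ , o₂ , o₃ , o₄) =
  tally-cong (min-orthogonal c₁ o₁) (min-orthogonal c₂ o₂) (min-orthogonal c₃ o₃) (min-orthogonal c₄ o₄)

excesses-assemble : ∀ c E → Orthogonal E → excesses (assemble c E) ≡ E
excesses-assemble (tally c₁ c₂ c₃ c₄) (tally d₁ d₂ d₃ d₄ , tally e₁ e₂ e₃ e₄) (o₁ , o₂ , o₃ , o₄) = cong₂ _,_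
  (tally-cong (∸-orthogonal c₁ o₁) (∸-orthogonal c₂ o₂) (∸-orthogonal c₃ o₃) (∸-orthogonal c₄ o₄))
  (tally-cong (∸-orthogonal c₁ (trans (⊓-comm e₁ d₁) o₁)) (∸-orthogonal c₂ (trans (⊓-comm e₂ d₂) o₂))
              (∸-orthogonal c₃ (trans (⊓-comm e₃ d₃) o₃)) (∸-orthogonal c₄ (trans (⊓-comm e₄ d₄) o₄)))

excessOf-orthogonal : ∀ α β s → Orthogonal (excessOf α β s)
excessOf-orthogonal α β s =
  [m∸n]⊓[n∸m]≡0 (bit α + bit β + neg s) (suc (pos s)) , [m∸n]⊓[n∸m]≡0 (pos s) (bit β + neg s) ,
  [m∸n]⊓[n∸m]≡0 (pos s) (bit α + neg s) , neg⊓pos s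
  where
  neg⊓pos : ∀ s → neg s ⊓ pos s ≡ 0
  neg⊓pos (ℤ.+ p)     = refl
  neg⊓pos -[1+ n ] = refl

offset-excessOf : ∀ α β s → offset (excessOf α β s) ≡ s
offset-excessOf α β (ℤ.+ p)     = refl
offset-excessOf α β -[1+ n ] = refl

private
  pos-neg-⊖ : ∀ {d e} → d ⊓ e ≡ 0 → pos (e ⊖ d) ≡ e × neg (e ⊖ d) ≡ d
  pos-neg-⊖ {zero}  {e}    _ = refl , refl
  pos-neg-⊖ {suc d} {zero} _ = refl , refl

  sum-of-balances : ∀ {e₁ e₂ e₃ d₁ d₂ d₃ p n A B} →
    e₁ + (A + B + n) ≡ d₁ + suc p → e₂ + p ≡ d₂ + (B + n) → e₃ + p ≡ d₃ + (A + n) →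
    e₁ + e₂ + e₃ + p ≡ suc (d₁ + d₂ + d₃ + n)
  sum-of-balances {e₁} {e₂} {e₃} {d₁} {d₂} {d₃} {p} {n} {A} {B} h₁ h₂ h₃ = +-cancelʳ-≡ _ _ _ (begin
    e₁ + e₂ + e₃ + p + (A + B + n + p + p)                 ≡⟨ shuffle e₁ e₂ e₃ p n A B ⟩
    (e₁ + (A + B + n)) + (e₂ + p) + (e₃ + p) + p           ≡⟨ cong₂ (λ x y → x + y + p) (cong₂ _+_ h₁ h₂) h₃ ⟩
    (d₁ + suc p) + (d₂ + (B + n)) + (d₃ + (A + n)) + p     ≡⟨ unshuffle d₁ d₂ d₃ p n A B ⟩
    suc (d₁ + d₂ + d₃ + n) + (A + B + n + p + p)           ∎)
    where
    open ≡-Reasoning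
    shuffle : ∀ e₁ e₂ e₃ p n A B → e₁ + e₂ + e₃ + p + (A + B + n + p + p) ≡ (e₁ + (A + B + n)) + (e₂ + p) + (e₃ + p) + p
    shuffle = solve-∀
    unshuffle : ∀ d₁ d₂ d₃ p n A B → (d₁ + suc p) + (d₂ + (B + n)) + (d₃ + (A + n)) + p ≡ suc (d₁ + d₂ + d₃ + n) + (A + B + n + p + p)
    unshuffle = solve-∀

  first-balance : ∀ {e₁ e₂ e₃ d₁ d₂ d₃ p n A B} →
    e₁ + e₂ + e₃ + p ≡ suc (d₁ + d₂ + d₃ + n) → e₂ + p ≡ d₂ + (B + n) → e₃ + p ≡ d₃ + (A + n) →
    e₁ + (A + B + n) ≡ d₁ + suc p
  first-balance {e₁} {e₂} {e₃} {d₁} {d₂} {d₃} {p} {n} {A} {B} total h₂ h₃ = +-cancelʳ-≡ _ _ _ (begin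
    e₁ + (A + B + n) + ((e₂ + p) + (e₃ + p))               ≡⟨ shuffle e₁ e₂ e₃ p n A B ⟩
    e₁ + e₂ + e₃ + p + (A + B + n + p)                     ≡⟨ cong (_+ (A + B + n + p)) total ⟩
    suc (d₁ + d₂ + d₃ + n) + (A + B + n + p)               ≡⟨ unshuffle d₁ d₂ d₃ p n A B ⟩
    d₁ + suc p + ((d₂ + (B + n)) + (d₃ + (A + n)))         ≡⟨ cong (λ x → d₁ + suc p + x) (cong₂ _+_ h₂ h₃) ⟨
    d₁ + suc p + ((e₂ + p) + (e₃ + p))                     ∎)
    where
    open ≡-Reasoning
    shuffle : ∀ e₁ e₂ e₃ p n A B → e₁ + (A + B + n) + ((e₂ + p) + (e₃ + p)) ≡ e₁ + e₂ + e₃ + p + (A + B + n + p)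
    shuffle = solve-∀
    unshuffle : ∀ d₁ d₂ d₃ p n A B → suc (d₁ + d₂ + d₃ + n) + (A + B + n + p) ≡ d₁ + suc p + ((d₂ + (B + n)) + (d₃ + (A + n)))
    unshuffle = solve-∀

private
  swap-balance : ∀ {e d p n A} → e + p ≡ d + (A + n) → p + e ≡ d + n + A
  swap-balance {e} {d} {p} {n} {A} h = trans (+-comm p e) (trans h (rearrange d n A))
    where
    rearrange : ∀ d n A → d + (A + n) ≡ d + n + A
    rearrange = solve-∀

  unswap-balance : ∀ {e d p n A} → p + e ≡ d + n + A → e + p ≡ d + (A + n)
  unswap-balance {e} {d} {p} {n} {A} h = trans (+-comm e p) (trans h (rearrange d n A))
    where
    rearrange : ∀ d n A → d + n + A ≡ d + (A + n)
    rearrange = solve-∀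

excessOf-balanced : ∀ α β s → Balanced α β (excessOf α β s)
excessOf-balanced α β s =
  sum-of-balances {e₁} {e₂} {e₃} {d₁} {d₂} {d₃} {s⁺} {s⁻} {a} {b} b₁ b₂ b₃ ,
  swap-balance {e₃} {d₃} {s⁺} {s⁻} {a} b₃ , swap-balance {e₂} {d₂} {s⁺} {s⁻} {b} b₂
  where
  s⁺ = pos s
  s⁻ = neg s
  a = bit α
  b = bit β
  d₁ = a + b + s⁻ ∸ suc s⁺
  e₁ = suc s⁺ ∸ (a + b + s⁻)
  d₂ = s⁺ ∸ (b + s⁻)
  e₂ = b + s⁻ ∸ s⁺
  d₃ = s⁺ ∸ (a + s⁻)
  e₃ = a + s⁻ ∸ s⁺
  b₁ : e₁ + (a + b + s⁻) ≡ d₁ + suc s⁺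
  b₁ = ∸-balanced (a + b + s⁻) (suc s⁺)
  b₂ : e₂ + s⁺ ≡ d₂ + (b + s⁻)
  b₂ = ∸-balanced s⁺ (b + s⁻)
  b₃ : e₃ + s⁺ ≡ d₃ + (a + s⁻)
  b₃ = ∸-balanced s⁺ (a + s⁻)

balanced⇒excessOf : ∀ α β E → Orthogonal E → Balanced α β E → E ≡ excessOf α β (offset E)
balanced⇒excessOf α β (tally d₁ d₂ d₃ d₄ , tally e₁ e₂ e₃ e₄) (o₁ , o₂ , o₃ , o₄) (total , h₃ , h₂)
  rewrite proj₁ (pos-neg-⊖ {d₄} {e₄} o₄) | proj₂ (pos-neg-⊖ {d₄} {e₄} o₄) = cong₂ _,_
    (tally-cong (proj₁ pair₁) (proj₁ pair₂) (proj₁ pair₃) refl)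
    (tally-cong (proj₂ pair₁) (proj₂ pair₂) (proj₂ pair₃) refl)
  where
  a = bit α
  b = bit β
  pair₂ = orthogonal-balanced e₄ (b + d₄) o₂ (unswap-balance {e₂} {d₂} {e₄} {d₄} {b} h₂)
  pair₃ = orthogonal-balanced e₄ (a + d₄) o₃ (unswap-balance {e₃} {d₃} {e₄} {d₄} {a} h₃)
  pair₁ = orthogonal-balanced (a + b + d₄) (suc e₄) o₁
            (first-balance {e₁} {e₂} {e₃} {d₁} {d₂} {d₃} {e₄} {d₄} {a} {b} total
              (unswap-balance {e₂} {d₂} {e₄} {d₄} {b} h₂) (unswap-balance {e₃} {d₃} {e₄} {d₄} {a} h₃))

record Sized (m : ℕ) (α β : Bool) (R : Tally × Tally) : Set where
  field
    inner-total : total (proj₁ R) ≡ m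
    outer-total : total (proj₂ R) ≡ suc m
    y-size      : proj₁ (uncurry keyOf R) ≡ m + bit α
    z-size      : proj₁ (proj₂ (uncurry keyOf R)) ≡ m + bit β

private
  assemble-sums : ∀ c₁ c₂ c₃ c₄ d₁ d₂ d₃ d₄ e₁ e₂ e₃ e₄ →
    let l , r = assemble (tally c₁ c₂ c₃ c₄) (tally d₁ d₂ d₃ d₄ , tally e₁ e₂ e₃ e₄)
        c = c₁ + c₂ + c₃ + c₄ in
    total l ≡ c + (d₁ + d₂ + d₃ + d₄) × total r ≡ c + (e₁ + e₂ + e₃ + e₄) ×
    proj₁ (keyOf l r) ≡ c + (d₁ + d₂ + (e₄ + e₃)) × proj₁ (proj₂ (keyOf l r)) ≡ c + (d₁ + d₃ + (e₄ + e₂))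
  assemble-sums c₁ c₂ c₃ c₄ d₁ d₂ d₃ d₄ e₁ e₂ e₃ e₄ = l-sum c₁ c₂ c₃ c₄ d₁ d₂ d₃ d₄ , r-sum c₁ c₂ c₃ c₄ e₁ e₂ e₃ e₄ ,
    y-sum c₁ c₂ c₃ c₄ d₁ d₂ e₃ e₄ , z-sum c₁ c₂ c₃ c₄ d₁ d₃ e₂ e₄
    where
    l-sum : ∀ c₁ c₂ c₃ c₄ d₁ d₂ d₃ d₄ → c₁ + d₁ + (c₂ + d₂) + (c₃ + d₃) + (c₄ + d₄) ≡ c₁ + c₂ + c₃ + c₄ + (d₁ + d₂ + d₃ + d₄)
    l-sum = solve-∀
    r-sum : ∀ c₁ c₂ c₃ c₄ e₁ e₂ e₃ e₄ → c₄ + e₄ + (c₃ + e₃) + (c₂ + e₂) + (c₁ + e₁) ≡ c₁ + c₂ + c₃ + c₄ + (e₁ + e₂ + e₃ + e₄)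
    r-sum = solve-∀
    y-sum : ∀ c₁ c₂ c₃ c₄ d₁ d₂ e₃ e₄ → c₁ + d₁ + (c₂ + d₂) + (c₄ + e₄ + (c₃ + e₃)) ≡ c₁ + c₂ + c₃ + c₄ + (d₁ + d₂ + (e₄ + e₃))
    y-sum = solve-∀
    z-sum : ∀ c₁ c₂ c₃ c₄ d₁ d₃ e₂ e₄ → c₁ + d₁ + (c₃ + d₃) + (c₄ + e₄ + (c₂ + e₂)) ≡ c₁ + c₂ + c₃ + c₄ + (d₁ + d₃ + (e₄ + e₂))
    z-sum = solve-∀

  regroup : ∀ Σc d₁ d₂ d₃ d₄ A → Σc + (d₁ + d₂ + (d₃ + d₄ + A)) ≡ Σc + (d₁ + d₂ + d₃ + d₄) + A
  regroup = solve-∀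

  regroup′ : ∀ Σc d₁ d₂ d₃ d₄ B → Σc + (d₁ + d₃ + (d₂ + d₄ + B)) ≡ Σc + (d₁ + d₂ + d₃ + d₄) + B
  regroup′ = solve-∀

sized-assemble : ∀ {m α β} c E → total c + total (proj₁ E) ≡ m → Balanced α β E → Sized m α β (assemble c E)
sized-assemble {m} {α} {β} (tally c₁ c₂ c₃ c₄) (tally d₁ d₂ d₃ d₄ , tally e₁ e₂ e₃ e₄) C+D≡m (E≡1+D , a-bal , b-bal)
  with assemble-sums c₁ c₂ c₃ c₄ d₁ d₂ d₃ d₄ e₁ e₂ e₃ e₄
... | l-sum , r-sum , y-sum , z-sum = record
  { inner-total = trans l-sum C+D≡m
  ; outer-total = trans r-sum (trans (cong (λ x → Σc + x) E≡1+D) (trans (+-suc Σc _) (cong suc C+D≡m)))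
  ; y-size      = trans y-sum (trans (cong (λ x → Σc + (d₁ + d₂ + x)) a-bal)
                    (trans (regroup Σc d₁ d₂ d₃ d₄ (bit α)) (cong (_+ bit α) C+D≡m)))
  ; z-size      = trans z-sum (trans (cong (λ x → Σc + (d₁ + d₃ + x)) b-bal)
                    (trans (regroup′ Σc d₁ d₂ d₃ d₄ (bit β)) (cong (_+ bit β) C+D≡m)))
  }
  where Σc = c₁ + c₂ + c₃ + c₄

assemble-sized : ∀ {m α β} c E → Sized m α β (assemble c E) → total c + total (proj₁ E) ≡ m × Balanced α β E
assemble-sized {m} {α} {β} (tally c₁ c₂ c₃ c₄) (tally d₁ d₂ d₃ d₄ , tally e₁ e₂ e₃ e₄) sized
  with assemble-sums c₁ c₂ c₃ c₄ d₁ d₂ d₃ d₄ e₁ e₂ e₃ e₄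
... | l-sum , r-sum , y-sum , z-sum = C+D≡m ,
  +-cancelˡ-≡ Σc _ _ (trans (sym r-sum) (trans (Sized.outer-total sized) (trans (cong suc (sym C+D≡m)) (sym (+-suc Σc _))))) ,
  +-cancelˡ-≡ (d₁ + d₂) _ _ (+-cancelˡ-≡ Σc _ _ (trans (sym y-sum) (trans (Sized.y-size sized)
    (trans (cong (_+ bit α) (sym C+D≡m)) (sym (regroup Σc d₁ d₂ d₃ d₄ (bit α))))))) ,
  +-cancelˡ-≡ (d₁ + d₃) _ _ (+-cancelˡ-≡ Σc _ _ (trans (sym z-sum) (trans (Sized.z-size sized)
    (trans (cong (_+ bit β) (sym C+D≡m)) (sym (regroup′ Σc d₁ d₂ d₃ d₄ (bit β)))))))
  where
  Σc = c₁ + c₂ + c₃ + c₄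
  C+D≡m : Σc + (d₁ + d₂ + d₃ + d₄) ≡ m
  C+D≡m = trans (sym l-sum) (Sized.inner-total sized)

record Composition (k n : ℕ) : Set where
  constructor composition
  field
    parts  : Vec ℕ (suc k)
    .sum≡  : sum parts ≡ n

composition-≡ : ∀ {k n} {u v : Vec ℕ (suc k)} .{p : sum u ≡ n} .{q : sum v ≡ n} → u ≡ v → composition u p ≡ composition v q
composition-≡ refl = refl

private
  Fin-cong : ∀ {a b} → a ≡ b → Fin a ↔ Fin b
  Fin-cong refl = ↔-refl

  one-part : ∀ n → Composition 0 n ↔ ⊤
  one-part n = mk↔ₛ′ (λ _ → tt) (λ _ → composition (n ∷ []) (+-identityʳ n)) (λ _ → refl)
    λ { (composition (x ∷ []) x+0≡n) → composition-≡ (cong (_∷ [])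
          (sym (trans (sym (+-identityʳ x)) (recompute (x + 0 ≟ n) x+0≡n)))) }

  all-zero : ∀ {k} (v : Vec ℕ k) → sum v ≡ 0 → v ≡ replicate k 0
  all-zero []         _   = refl
  all-zero (zero ∷ v) sum≡0 = cong (0 ∷_) (all-zero v sum≡0)

  sum-replicate-0 : ∀ k → sum (replicate k 0) ≡ 0
  sum-replicate-0 zero    = refl
  sum-replicate-0 (suc k) = sum-replicate-0 k

  of-zero : ∀ k → Composition (suc k) 0 ↔ ⊤
  of-zero k = mk↔ₛ′ (λ _ → tt) (λ _ → composition (replicate (suc (suc k)) 0) (sum-replicate-0 (suc (suc k)))) (λ _ → refl)
    λ { (composition v sum≡0) → composition-≡ (sym (all-zero v (recompute (sum v ≟ 0) sum≡0))) }

  -- the first part is either zero (and is dropped) or positive (and is decremented)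
  split-first : ∀ k n → Composition (suc k) (suc n) ↔ (Composition k (suc n) ⊎ Composition (suc k) n)
  split-first k n = mk↔ₛ′ to from to∘from from∘to
    where
    to : Composition (suc k) (suc n) → Composition k (suc n) ⊎ Composition (suc k) n
    to (composition (zero  ∷ v) sum≡) = inj₁ (composition v sum≡)
    to (composition (suc x ∷ v) sum≡) = inj₂ (composition (x ∷ v) (suc-injective sum≡))
    from : Composition k (suc n) ⊎ Composition (suc k) n → Composition (suc k) (suc n)
    from (inj₁ (composition v       sum≡)) = composition (0 ∷ v) sum≡
    from (inj₂ (composition (x ∷ v) sum≡)) = composition (suc x ∷ v) (cong suc sum≡)
    to∘from : ∀ c → to (from c) ≡ c
    to∘from (inj₁ (composition v       _)) = refl
    to∘from (inj₂ (composition (x ∷ v) _)) = refl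
    from∘to : ∀ c → from (to c) ≡ c
    from∘to (composition (zero  ∷ v) _) = refl
    from∘to (composition (suc x ∷ v) _) = refl

  pascal : ∀ k n → (suc n + k) C k + (n + suc k) C suc k ≡ (suc n + suc k) C suc k
  pascal k n = trans (cong (λ a → a C k + (n + suc k) C suc k) (sym (+-suc n k)))
                     (nCk+nC[k+1]≡[n+1]C[k+1] (n + suc k) k)

Fin-C↔Composition : ∀ k n → Fin ((n + k) C k) ↔ Composition k n
Fin-C↔Composition zero    n       = ↔-trans 1↔⊤ (↔-sym (one-part n))
Fin-C↔Composition (suc k) zero    = ↔-trans (Fin-cong (nCn≡1 (suc k))) (↔-trans 1↔⊤ (↔-sym (of-zero k)))
Fin-C↔Composition (suc k) (suc n) =
  ↔-trans (Fin-cong (sym (pascal k n)))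
  (↔-trans +↔⊎ (↔-trans (Fin-C↔Composition k (suc n) ⊎-↔ Fin-C↔Composition (suc k) n) (↔-sym (split-first k n))))

sizeBit : ℕ → ℕ → Bool
sizeBit m a = does (a ≟ suc m)

IsSize⇒ : ∀ {a} → IsSize m a → a ≡ m + bit (sizeBit m a)
IsSize⇒ {m} {a} (inj₁ a≡m) rewrite dec-false (a ≟ suc m) (λ a≡1+m → m≢1+m+n m (trans (sym a≡m) (trans a≡1+m (cong suc (sym (+-identityʳ m))))))
  = trans a≡m (sym (+-identityʳ m))
IsSize⇒ {m} {a} (inj₂ a≡1+m) rewrite dec-true (a ≟ suc m) a≡1+m = trans a≡1+m (+-comm 1 m)

sizeBit-bit : ∀ m α → sizeBit m (m + bit α) ≡ α
sizeBit-bit m true  = dec-true (m + 1 ≟ suc m) (+-comm m 1)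
sizeBit-bit m false = dec-false (m + 0 ≟ suc m) (λ m+0≡1+m → m≢1+m+n m (trans (sym (+-identityʳ m)) (trans m+0≡1+m (cong suc (sym (+-identityʳ m))))))

bit-IsSize : ∀ α → IsSize m (m + bit α)
bit-IsSize {m} false = inj₁ (+-identityʳ m)
bit-IsSize {m} true  = inj₂ (+-comm m 1)

valid? : ∀ m R → Dec (Valid m R)
valid? m (l , r) = total l ≟ m ×-dec total r ≟ suc m ×-dec (a ≟ m ⊎-dec a ≟ suc m) ×-dec (b ≟ m ⊎-dec b ≟ suc m)
  where
  a = proj₁ (keyOf l r)
  b = proj₁ (proj₂ (keyOf l r))

private
  classOf : ℕ → Tally × Tally → Bool × Bool
  classOf m R = sizeBit m (proj₁ (uncurry keyOf R)) , sizeBit m (proj₁ (proj₂ (uncurry keyOf R)))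

  Valid⇒Sized : ∀ R → Valid m R → Sized m (proj₁ (classOf m R)) (proj₂ (classOf m R)) R
  Valid⇒Sized R (l-total , r-total , y-size , z-size) = record
    { inner-total = l-total ; outer-total = r-total ; y-size = IsSize⇒ y-size ; z-size = IsSize⇒ z-size }

  Sized⇒Valid : ∀ {α β} R → Sized m α β R → Valid m R
  Sized⇒Valid {α = α} {β} R sized = Sized.inner-total sized , Sized.outer-total sized ,
    subst (IsSize _) (sym (Sized.y-size sized)) (bit-IsSize α) , subst (IsSize _) (sym (Sized.z-size sized)) (bit-IsSize β)

  parts-sum : ∀ k c₁ c₂ c₃ c₄ → k + (c₁ + (c₂ + (c₃ + (c₄ + 0)))) ≡ c₁ + c₂ + c₃ + c₄ + k
  parts-sum = solve-∀

decompose : ∀ R → Valid m R →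
  let α , β = classOf m R ; s = offset (excesses R) in
  R ≡ assemble (common R) (excessOf α β s) × total (common R) + zigzag (recentre α β s) ≡ m
decompose R valid with assemble-sized (common R) (excesses R)
                         (subst (Sized _ _ _) (sym (assemble-common-excesses R)) (Valid⇒Sized R valid))
... | C+D≡m , balanced = trans (sym (assemble-common-excesses R)) (cong (assemble (common R)) E≡) ,
                         trans (cong (total (common R) +_) D≡) C+D≡m
  where
  α = proj₁ (classOf _ R)
  β = proj₂ (classOf _ R)
  s = offset (excesses R)
  E≡ = balanced⇒excessOf α β (excesses R) (excesses-orthogonal R) balanced
  D≡ : zigzag (recentre α β s) ≡ total (proj₁ (excesses R))
  D≡ = trans (sym (deficit-zigzag α β s)) (cong (λ E → total (proj₁ E)) (sym E≡))

Region↔Class×Composition : Region m ↔ ((Bool × Bool) × Composition 4 m)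
Region↔Class×Composition {m} = mk↔ₛ′ decode encode decode∘encode encode∘decode
  where
  encode : (Bool × Bool) × Composition 4 m → Region m
  encode ((α , β) , composition (k ∷ c₁ ∷ c₂ ∷ c₃ ∷ c₄ ∷ []) sum≡) =
    region (assemble c E) (Sized⇒Valid (assemble c E) (sized-assemble c E (C+D≡m sum≡) (excessOf-balanced α β s)))
    where
    c = tally c₁ c₂ c₃ c₄
    s = uncentre α β (unzigzag k)
    E = excessOf α β s
    C+D≡m : k + (c₁ + (c₂ + (c₃ + (c₄ + 0)))) ≡ m → total c + total (proj₁ E) ≡ m
    C+D≡m sum≡ = trans (cong (total c +_) (trans (deficit-zigzag α β s)
                   (trans (cong zigzag (recentre-uncentre α β (unzigzag k))) (zigzag-unzigzag k))))
                 (trans (sym (parts-sum k c₁ c₂ c₃ c₄)) sum≡)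

  decode : Region m → (Bool × Bool) × Composition 4 m
  decode (region R valid) = classOf m R ,
    composition (zigzag (recentre α β s) ∷ c₁ ∷ c₂ ∷ c₃ ∷ c₄ ∷ [])
                (trans (parts-sum _ c₁ c₂ c₃ c₄) (proj₂ (decompose R valid)))
    where
    α = proj₁ (classOf m R)
    β = proj₂ (classOf m R)
    s = offset (excesses R)
    c₁ = Tally.both (common R)
    c₂ = Tally.only-y (common R)
    c₃ = Tally.only-z (common R)
    c₄ = Tally.neither (common R)

  encode∘decode : ∀ R → encode (decode R) ≡ R
  encode∘decode (region R valid) = region-≡ (trans
    (cong (λ s → assemble (common R) (excessOf α β s))
          (trans (cong (uncentre α β) (unzigzag-zigzag (recentre α β s))) (uncentre-recentre α β s)))
    (sym (proj₁ (decompose R (recompute (valid? m R) valid)))))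
    where
    α = proj₁ (classOf m R)
    β = proj₂ (classOf m R)
    s = offset (excesses R)

  decode∘encode : ∀ x → decode (encode x) ≡ x
  decode∘encode ((α , β) , composition (k ∷ c₁ ∷ c₂ ∷ c₃ ∷ c₄ ∷ []) sum≡) =
    cong₂ _,_ (cong₂ _,_ α′≡α β′≡β) (composition-≡ (cong₂ _∷_ k′≡k (cong (λ c → Tally.both c ∷ Tally.only-y c ∷ Tally.only-z c ∷ Tally.neither c ∷ []) c′≡c)))
    where
    c = tally c₁ c₂ c₃ c₄
    s = uncentre α β (unzigzag k)
    E = excessOf α β s
    orthogonal = excessOf-orthogonal α β s
    sized : Sized m α β (assemble c E)
    sized = sized-assemble c E (trans (cong (total c +_) (trans (deficit-zigzag α β s)
                   (trans (cong zigzag (recentre-uncentre α β (unzigzag k))) (zigzag-unzigzag k))))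
                 (trans (sym (parts-sum k c₁ c₂ c₃ c₄)) (recompute (_ ≟ m) sum≡))) (excessOf-balanced α β s)
    α′≡α : sizeBit m (proj₁ (uncurry keyOf (assemble c E))) ≡ α
    α′≡α = trans (cong (sizeBit m) (Sized.y-size sized)) (sizeBit-bit m α)
    β′≡β : sizeBit m (proj₁ (proj₂ (uncurry keyOf (assemble c E)))) ≡ β
    β′≡β = trans (cong (sizeBit m) (Sized.z-size sized)) (sizeBit-bit m β)
    c′≡c : common (assemble c E) ≡ c
    c′≡c = common-assemble c E orthogonal
    k′≡k : zigzag (recentre (sizeBit m (proj₁ (uncurry keyOf (assemble c E)))) (sizeBit m (proj₁ (proj₂ (uncurry keyOf (assemble c E)))))
                               (offset (excesses (assemble c E)))) ≡ k
    k′≡k = trans (cong₂ (λ α′ β′ → zigzag (recentre α′ β′ (offset (excesses (assemble c E))))) α′≡α β′≡β)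
           (trans (cong (λ E′ → zigzag (recentre α β (offset E′))) (excesses-assemble c E orthogonal))
           (trans (cong (zigzag ∘ recentre α β) (offset-excessOf α β s))
           (trans (cong zigzag (recentre-uncentre α β (unzigzag k))) (zigzag-unzigzag k))))

-- The basis

module _ {c ℓ} (F : Field c ℓ) {m : ℕ} where
  open Field F using (Carrier; _≈_; 0#; 1#)
    renaming ( _*_ to _·_; +-cong to +ᶠ-cong; *-cong to ·-cong; zeroʳ to ·-zeroʳ; *-identityʳ to ·-identityʳ
             ; +-identityˡ to +ᶠ-identityˡ; +-identityʳ to +ᶠ-identityʳ
             ; refl to ≈-refl; sym to ≈-sym; trans to ≈-trans; reflexive to ≈-reflexive)

  private
    N-value : (x : Idx m) (y z : Vtx m) → N F x y z ≡ (if does (key y z ≟ᵏ keyIdx x) then 1# else 0#)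
    N-value (idx _ _ _ _ _ _) y z = refl

  N-matching : (x : Idx m) (y z : Vtx m) → key y z ≡ keyIdx x → N F x y z ≡ 1#
  N-matching x y z matching rewrite N-value x y z | dec-true (key y z ≟ᵏ keyIdx x) matching = refl

  N-mismatching : (x : Idx m) (y z : Vtx m) → key y z ≢ keyIdx x → N F x y z ≡ 0#
  N-mismatching x y z mismatching rewrite N-value x y z | dec-false (key y z ≟ᵏ keyIdx x) mismatching = refl

  N∈𝒜 : (x : Idx m) → InCentralizer F (N F x)
  N∈𝒜 x σ σ∈G y z = ≈-reflexive (trans (N-value x (app σ y) (app σ z))
                      (trans (cong (λ κ → if does (κ ≟ᵏ keyIdx x) then 1# else 0#) (key-app σ σ∈G y z))
                             (sym (N-value x y z))))

  ∑-zero : ∀ {n} (f : Fin n → Carrier) → (∀ k → f k ≈ 0#) → ∑ F f ≈ 0#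
  ∑-zero {zero}  f f≈0 = ≈-refl
  ∑-zero {suc n} f f≈0 = ≈-trans (+ᶠ-cong (f≈0 Fin.zero) (∑-zero (f ∘ Fin.suc) (f≈0 ∘ Fin.suc))) (+ᶠ-identityˡ 0#)

  ∑-single : ∀ {n} (f : Fin n → Carrier) (k₀ : Fin n) → (∀ k → k ≢ k₀ → f k ≈ 0#) → ∑ F f ≈ f k₀
  ∑-single {suc n} f Fin.zero     f≈0 =
    ≈-trans (+ᶠ-cong ≈-refl (∑-zero (f ∘ Fin.suc) (λ k → f≈0 (Fin.suc k) λ ()))) (+ᶠ-identityʳ _)
  ∑-single {suc n} f (Fin.suc k₀) f≈0 =
    ≈-trans (+ᶠ-cong (f≈0 Fin.zero λ ()) (∑-single (f ∘ Fin.suc) k₀ (λ k k≢k₀ → f≈0 (Fin.suc k) (k≢k₀ ∘ Finₚ.suc-injective))))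
            (+ᶠ-identityˡ _)

  module _ {d : ℕ} (e : Fin d ↔ Idx m) where
    private
      module e = Inverse e
      v = N F ∘ e.to

    lincomb-at : (coeff : Fin d → Carrier) (y z : Vtx m) (k₀ : Fin d) → key y z ≡ keyIdx (e.to k₀) →
                 lincomb F coeff v y z ≈ coeff k₀
    lincomb-at coeff y z k₀ matching = ≈-trans (∑-single _ k₀ off) on
      where
      to-injective : ∀ {k k′} → e.to k ≡ e.to k′ → k ≡ k′
      to-injective {k} {k′} eq = trans (sym (e.strictlyInverseʳ k)) (trans (cong e.from eq) (e.strictlyInverseʳ k′))
      off : ∀ k → k ≢ k₀ → coeff k · v k y z ≈ 0#
      off k k≢k₀ = ≈-trans (·-cong ≈-refl (≈-reflexive (N-mismatching (e.to k) y z λ matching′ →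
                     k≢k₀ (to-injective (idx-≡ (trans (sym matching′) matching)))))) (·-zeroʳ _)
      on : coeff k₀ · v k₀ y z ≈ coeff k₀
      on = ≈-trans (·-cong ≈-refl (≈-reflexive (N-matching (e.to k₀) y z matching))) (·-identityʳ _)

    independent : ∀ coeff → (∀ y z → lincomb F coeff v y z ≈ 0#) → ∀ k → coeff k ≈ 0#
    independent coeff vanishes k = ≈-trans (≈-sym (lincomb-at coeff y z k (key-witness (e.to k)))) (vanishes y z)
      where
      y = proj₁ (witness (e.to k))
      z = proj₂ (witness (e.to k))

    spanning : ∀ B → InCentralizer F B → ∃[ coeff ] (∀ y z → B y z ≈ lincomb F coeff v y z)
    spanning B B∈𝒜 = coeff , λ y z → ≈-trans (B-at y z) (≈-sym (lincomb-at coeff y z (e.from (idxOf y z)) (key-at y z)))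
      where
      coeff : Fin d → Carrier
      coeff k = B (proj₁ (witness (e.to k))) (proj₂ (witness (e.to k)))
      key-at : ∀ y z → key y z ≡ keyIdx (e.to (e.from (idxOf y z)))
      key-at y z = cong keyIdx (sym (e.strictlyInverseˡ (idxOf y z)))
      B-at : ∀ y z → B y z ≈ coeff (e.from (idxOf y z))
      B-at y z = ≈-trans (constant-on-regions F B∈𝒜 (sym (regions-witness-idxOf y z)))
        (≈-reflexive (cong (λ x → B (proj₁ (witness x)) (proj₂ (witness x))) (sym (e.strictlyInverseˡ (idxOf y z)))))

Fin4↔Bool×Bool : Fin 4 ↔ (Bool × Bool)
Fin4↔Bool×Bool = ↔-trans *↔× (2↔Bool ×-↔ 2↔Bool)

enumeration : ∀ m → Fin (4 * ((m + 4) C 4)) ↔ Idx m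
enumeration m = ↔-trans *↔× (↔-trans (Fin4↔Bool×Bool ×-↔ Fin-C↔Composition 4 m)
                  (↔-trans (↔-sym Region↔Class×Composition) (↔-sym Idx↔Region)))

theorem3p4 : ∀ {c ℓ} (F : Field c ℓ) (m : ℕ) → 1 ≤ m →
    Σ[ e ∈ Fin (4 * ((m + 4) C 4)) ↔ Idx m ]
      IsBasisOf F (InCentralizer F) (N F ∘ Inverse.to e)
theorem3p4 F m _ = e , N∈𝒜 F ∘ Inverse.to e , independent F e , spanning F e
  where e = enumeration m
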